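{- Let $n\ge1$, $R\le D_8$, and $T$ a set of tile designs for $R$. For $g\in R$ let $\mathrm{Fix}_g(n)$ be the number of tilings of the $n\times n$ grid by $T$ fixed by $g$. Then (for the relevant $g\in R$): $\mathrm{Fix}_{\mathrm{id}}(n)=t_{\mathrm{id}}^{n^2}$; $\mathrm{Fix}_{r^2}(n)=t_{\mathrm{id}}^{n^2/2}$ if $n$ even, $t_{\mathrm{id}}^{(n^2-1)/2}t_{r^2}$ if $n$ odd; $\mathrm{Fix}_{f}(n)=t_{\mathrm{id}}^{n^2/2}$ if $n$ even, $t_{\mathrm{id}}^{(n^2-n)/2}t_f^n$ if $n$ odd; $\mathrm{Fix}_{r^2f}(n)=t_{\mathrm{id}}^{n^2/2}$ if $n$ even, $t_{\mathrm{id}}^{(n^2-n)/2}t_{r^2f}^n$ if $n$ odd; $\mathrm{Fix}_{r}(n)=\mathrm{Fix}_{r^3}(n)=t_{\mathrm{id}}^{n^2/4}$ if $n$ even, $t_{\mathrm{id}}^{(n^2-1)/4}t_r$ if $n$ odd; $\mathrm{Fix}_{rf}(n)=t_{\mathrm{id}}^{(n^2-n)/2}t_{rf}^n$; $\mathrm{Fix}_{r^3f}(n)=t_{\mathrm{id}}^{(n^2-n)/2}t_{r^3f}^n$. Moreover the number of distinct tilings of the $n\times n$ grid up to the action of $R$ is $\frac{1}{|R|}\sum_{g\in R}\mathrm{Fix}_g(n)$.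
   Context: The $n\times n$ grid is the set of cells $\mathbb{Z}/n\mathbb{Z}\times\mathbb{Z}/n\mathbb{Z}$. $D_8=\langle r,f\mid r^4=f^2=(rf)^2=\mathrm{id}\rangle$ acts on cells on the right, determined by $(x,y)\cdot f=(n-1-x,y)$ and $(x,y)\cdot r=(n-1-y,x)$; thus $r^2:(n-1-x,n-1-y)$, $r^3:(y,n-1-x)$, $r^2f:(x,n-1-y)$, $rf:(y,x)$, $r^3f:(n-1-y,n-1-x)$. A set of tile designs for $R$ is a finite set $T$ with a right action of $R$; $t_g=|\{d\in T:d\cdot g=d\}|$. A tiling is a map $\tau$ from cells to $T$; $g$ acts on tilings by $(\tau\cdot g)(c\cdot g)=\tau(c)\cdot g$, and $\tau$ is fixed by $g$ if $\tau(c\cdot g)=\tau(c)\cdot g$ for all $c$. Distinct tilings up to $R$ means orbits under this action. -}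

module Defs where

open import Data.Bool using (Bool; true; false; T)
open import Data.Unit using (⊤; tt)
open import Data.Nat using (ℕ; zero; suc; _*_; _+_)
open import Data.Fin using (Fin; zero; suc; opposite; _≟_)
open import Data.Fin.Properties using (all?)
open import Data.Product using (Σ; _×_; _,_; uncurry)
open import Data.List using (List; []; _∷_; map; concatMap; filter; length; allFin)
open import Data.Nat.ListAction using (sum)
open import Data.Product using (proj₁; proj₂)
open import Relation.Nullary using (Dec; map′)
open import Relation.Nullary.Decidable using (T?)
open import Data.List.Relation.Unary.Any using (Any)
open import Data.List.Relation.Unary.AllPairs using (AllPairs)
open import Relation.Binary.PropositionalEquality using (_≡_)
open import Relation.Nullary using (¬_)

-- The dihedral group D8, elements named as in the paper.
-- r = rotation, f = flip; the word "g h" means "first g then h"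
-- (right action), so e.g. rf = r · f.

data D8 : Set where
  e r r² r³ f rf r²f r³f : D8

allD8 : List D8
allD8 = e ∷ r ∷ r² ∷ r³ ∷ f ∷ rf ∷ r²f ∷ r³f ∷ []

-- group law, computed so that  c ⊙ (g · h) = (c ⊙ g) ⊙ h  (right action)
infixl 7 _·_
_·_ : D8 → D8 → D8
e · e = e
e · r = r
e · r² = r²
e · r³ = r³
e · f = f
e · r²f = r²f
e · rf = rf
e · r³f = r³f
r · e = r
r · r = r²
r · r² = r³
r · r³ = e
r · f = rf
r · r²f = r³f
r · rf = r²f
r · r³f = f
r² · e = r²
r² · r = r³
r² · r² = e
r² · r³ = r
r² · f = r²f
r² · r²f = f
r² · rf = r³f
r² · r³f = rf
r³ · e = r³
r³ · r = e
r³ · r² = r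
r³ · r³ = r²
r³ · f = r³f
r³ · r²f = rf
r³ · rf = f
r³ · r³f = r²f
f · e = f
f · r = r³f
f · r² = r²f
f · r³ = rf
f · f = e
f · r²f = r²
f · rf = r³
f · r³f = r
r²f · e = r²f
r²f · r = rf
r²f · r² = f
r²f · r³ = r³f
r²f · f = r²
r²f · r²f = e
r²f · rf = r
r²f · r³f = r³
rf · e = rf
rf · r = f
rf · r² = r³f
rf · r³ = r²f
rf · f = r
rf · r²f = r³
rf · rf = e
rf · r³f = r²
r³f · e = r³f
r³f · r = r²f
r³f · r² = rf
r³f · r³ = f
r³f · f = r³
r³f · r²f = r
r³f · rf = r²
r³f · r³f = e

inv : D8 → D8
inv e = e
inv r = r³
inv r² = r²
inv r³ = r
inv f = f
inv r²f = r²f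
inv rf = rf
inv r³f = r³f

Cell : ℕ → Set
Cell n = Fin n × Fin n

infixl 6 _⊙_
_⊙_ : ∀ {n} → Cell n → D8 → Cell n
(x , y) ⊙ e   = (x , y)
(x , y) ⊙ r   = (opposite y , x)
(x , y) ⊙ r²  = (opposite x , opposite y)
(x , y) ⊙ r³  = (y , opposite x)
(x , y) ⊙ f   = (opposite x , y)
(x , y) ⊙ rf  = (y , x)
(x , y) ⊙ r²f = (x , opposite y)
(x , y) ⊙ r³f = (opposite y , opposite x)

record Subgroup : Set where
  field
    mem       : D8 → Bool
    mem-e     : T (mem e)
    mem-·     : ∀ {g h} → T (mem g) → T (mem h) → T (mem (g · h))
    mem-inv   : ∀ {g} → T (mem g) → T (mem (inv g))

open Subgroup public

_∈_ : D8 → Subgroup → Set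
g ∈ R = T (mem R g)

order : Subgroup → ℕ
order R = length (filter (λ g → T? (mem R g)) allD8)

record TileSet (R : Subgroup) : Set where
  field
    m       : ℕ
    act     : Fin m → (g : D8) → g ∈ R → Fin m
    act-e   : ∀ d → act d e (mem-e R) ≡ d
    act-·   : ∀ d {g h} (p : g ∈ R) (q : h ∈ R) →
              act (act d g p) h q ≡ act d (g · h) (mem-· R p q)

open TileSet public

tcount : ∀ {R} (T' : TileSet R) (g : D8) → g ∈ R → ℕ
tcount T' g p = length (filter (λ d → act T' d g p ≟ d) (allFin (m T')))

Tiling : ℕ → ℕ → Set
Tiling n k = Cell n → Fin k

allFuns : ∀ {A : Set} → List A → (k : ℕ) → List (Fin k → A)
allFuns xs zero    = (λ ()) ∷ []
allFuns xs (suc k) =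
  concatMap (λ g → map (λ a → λ { zero → a ; (suc i) → g i }) xs) (allFuns xs k)

allTilings : (n k : ℕ) → List (Tiling n k)
allTilings n k = map uncurry (allFuns (allFuns (allFin k) n) n)

FixedBy : ∀ {R} (T' : TileSet R) {n} → Tiling n (m T') → (g : D8) → g ∈ R → Set
FixedBy T' τ g p = ∀ c → τ (c ⊙ g) ≡ act T' (τ c) g p

fixedBy? : ∀ {R} (T' : TileSet R) {n} (τ : Tiling n (m T')) (g : D8) (p : g ∈ R) →
           Dec (FixedBy T' τ g p)
fixedBy? T' τ g p =
  map′ (λ h c → h (proj₁ c) (proj₂ c))
                        (λ h x y → h (x , y))
    (all? (λ x → all? (λ y → τ ((x , y) ⊙ g) ≟ act T' (τ (x , y)) g p)))

Fix : ∀ {R} (T' : TileSet R) (n : ℕ) (g : D8) → g ∈ R → ℕ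
Fix T' n g p = length (filter (λ τ → fixedBy? T' τ g p) (allTilings n (m T')))

ifIn : (b : Bool) → (T b → ℕ) → ℕ
ifIn true  k = k tt
ifIn false k = 0

sumFix : ∀ {R} (T' : TileSet R) (n : ℕ) → ℕ
sumFix {R} T' n = sum (map (λ g → ifIn (mem R g) (Fix T' n g)) allD8)

-- Orbits of tilings under R.
-- σ ∼ τ  iff  σ = τ · g for some g ∈ R, i.e. σ (c ⊙ g) = τ(c) · g for all c.

SameOrbit : ∀ {R} (T' : TileSet R) {n} → Tiling n (m T') → Tiling n (m T') → Set
SameOrbit {R} T' σ τ = Σ D8 λ g → Σ (g ∈ R) λ p → ∀ c → σ (c ⊙ g) ≡ act T' (τ c) g p

IsOrbitCount : ∀ {R} (T' : TileSet R) (n : ℕ) → ℕ → Set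
IsOrbitCount T' n N =
  Σ (List (Tiling n (m T'))) λ reps →
      (length reps ≡ N)
    × (∀ τ → Any (SameOrbit T' τ) reps)
    × AllPairs (λ σ τ → ¬ SameOrbit T' σ τ) reps

-- A tiling fixed by g is a tiling equivariant for the permutations c ↦ c ⊙ g of the cells
-- and d ↦ d · g of the tiles. If g has order N and every cell not fixed by g lies in an
-- orbit of exactly N cells, such a tiling is determined freely by a tile fixed by g on each
-- fixed cell and an arbitrary tile on one chosen cell of every other orbit, so
-- Fix_g = t_id ^ L * t_g ^ F, where F is the number of fixed cells and n² = F + N L.
-- A rotation fixes only the centre, which exists iff n is odd; a reflection in a median
-- fixes the middle row or column, and one in a diagonal fixes its n diagonal cells.
-- The orbit count is Burnside's lemma: count the pairs (g, τ) with τ · g = τ by grouping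
-- each τ with the representative ρ of its orbit; the g with ρ · g = τ form a coset of the
-- stabiliser of τ, and each pair (ρ, g) determines τ.

module Submission where

open import Algebra.Properties.CommutativeSemigroup using (interchange)
open import Data.Bool using (true; false; T)
open import Data.Bool.Properties using (T-irrelevant)
open import Data.Empty using (⊥; ⊥-elim)
open import Data.Fin using (Fin; zero; suc; toℕ; fromℕ<; opposite; _≟_)
open import Data.Fin.Properties as Fin using (all?; opposite-prop; opposite-involutive; toℕ-injective; toℕ<n; toℕ-fromℕ<)
open import Data.List using (List; []; _∷_; _++_; map; concatMap; filter; foldr; length; allFin; upTo; cartesianProduct)
open import Data.List.Membership.Propositional using (lose) renaming (_∈_ to _∈ₗ_)
open import Data.List.Membership.Propositional.Properties using (∈-upTo⁺; ∈-upTo⁻)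
open import Data.List.Properties using (map-++; map-∘; map-tabulate; length-tabulate)
open import Data.List.Relation.Unary.All as All using (All; []; _∷_)
open import Data.List.Relation.Unary.All.Properties using (¬Any⇒All¬)
open import Data.List.Relation.Unary.AllPairs using (AllPairs; []; _∷_)
open import Data.List.Relation.Unary.Any as Any using (Any; here; there; any?; satisfied)
open import Data.Nat using (ℕ; zero; suc; pred; _+_; _*_; _^_; _∸_; _/_; _%_; _<_; _≤_; _<?_; NonZero; z≤n; s≤s; s<s)
  renaming (_≟_ to _≟ℕ_)
open import Data.Nat.DivMod using (m≡m%n+[m/n]*n; m%n<n; m<n⇒m%n≡m; n%n≡0; m*n/n≡m; [m+kn]%n≡m%n)
open import Data.Nat.GeneralisedArithmetic using (fold; fold-+)
open import Data.Nat.ListAction using (sum; product)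
open import Data.Nat.ListAction.Properties using (sum-++; product-++)
open import Data.Nat.Properties hiding (_≟_)
open import Data.Product using (Σ; ∃; _×_; _,_; proj₁; proj₂; uncurry)
open import Data.Product.Properties using (≡-dec)
open import Data.Sum as Sum using (_⊎_; inj₁; inj₂; [_,_]′)
open import Data.Unit using (⊤; tt)
open import Function using (_∘_)
open import Level using (0ℓ)
open import Relation.Binary.Bundles using (DecSetoid)
open import Relation.Binary.Definitions using (DecidableEquality; tri<; tri≈; tri>)
open import Relation.Binary.PropositionalEquality
open import Relation.Binary.PropositionalEquality.Properties using (decSetoid)
open import Relation.Nullary using (Dec; yes; no; ¬_; ¬?; map′)
open import Relation.Nullary.Decidable using (T?; _×-dec_)
open import Defs

-- Counting with indicator functions

𝟙 : ∀ {p} {P : Set p} → Dec P → ℕ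
𝟙 (yes _) = 1
𝟙 (no _)  = 0

module _ {p} {P : Set p} where

  𝟙-yes : (d : Dec P) → P → 𝟙 d ≡ 1
  𝟙-yes (yes _) _  = refl
  𝟙-yes (no ¬x) x = ⊥-elim (¬x x)

  𝟙-no : (d : Dec P) → ¬ P → 𝟙 d ≡ 0
  𝟙-no (yes x) ¬x = ⊥-elim (¬x x)
  𝟙-no (no _)  _  = refl

  𝟙-¬ : (d : Dec P) → 𝟙 d + 𝟙 (¬? d) ≡ 1
  𝟙-¬ (yes _) = refl
  𝟙-¬ (no _)  = refl

module _ {p q} {P : Set p} {Q : Set q} where

  𝟙-⇔ : (a : Dec P) (b : Dec Q) → (P → Q) → (Q → P) → 𝟙 a ≡ 𝟙 b
  𝟙-⇔ a       (yes y) _   from = 𝟙-yes a (from y)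
  𝟙-⇔ a       (no ¬y) to  _    = 𝟙-no a (¬y ∘ to)

  𝟙-×-dec : (a : Dec P) (b : Dec Q) → 𝟙 (a ×-dec b) ≡ 𝟙 a * 𝟙 b
  𝟙-×-dec (yes _) (yes _) = refl
  𝟙-×-dec (yes _) (no _)  = refl
  𝟙-×-dec (no _)  _       = refl

module _ {p q r} {P : Set p} {Q : Set q} {R : Set r} where

  𝟙-⊎ : (a : Dec P) (b : Dec Q) (c : Dec R) → (R → P ⊎ Q) → (P ⊎ Q → R) → (P → ¬ Q) →
        𝟙 c ≡ 𝟙 a + 𝟙 b
  𝟙-⊎ (yes x) (yes y) c to from disjoint = ⊥-elim (disjoint x y)
  𝟙-⊎ (yes x) (no ¬y) c to from disjoint = 𝟙-yes c (from (inj₁ x))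
  𝟙-⊎ (no ¬x) (yes y) c to from disjoint = 𝟙-yes c (from (inj₂ y))
  𝟙-⊎ (no ¬x) (no ¬y) c to from disjoint = 𝟙-no c (λ z → [ ¬x , ¬y ]′ (to z))

∑ : {A : Set} → List A → (A → ℕ) → ℕ
∑ xs h = sum (map h xs)

syntax ∑ xs (λ x → h) = ∑[ x ← xs ] h

∏ : {A : Set} → List A → (A → ℕ) → ℕ
∏ xs h = product (map h xs)

syntax ∏ xs (λ x → h) = ∏[ x ← xs ] h

private variable A B : Set

∑-cong : (xs : List A) {g h : A → ℕ} → (∀ x → g x ≡ h x) → ∑ xs g ≡ ∑ xs h
∑-cong []       eq = refl
∑-cong (x ∷ xs) eq = cong₂ _+_ (eq x) (∑-cong xs eq)

∏-cong : (xs : List A) {g h : A → ℕ} → (∀ x → g x ≡ h x) → ∏ xs g ≡ ∏ xs h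
∏-cong []       eq = refl
∏-cong (x ∷ xs) eq = cong₂ _*_ (eq x) (∏-cong xs eq)

∏-one : (xs : List A) {h : A → ℕ} → (∀ x → h x ≡ 1) → ∏ xs h ≡ 1
∏-one []       eq = refl
∏-one (x ∷ xs) eq = cong₂ _*_ (eq x) (∏-one xs eq)

∑-zero : (xs : List A) {h : A → ℕ} → (∀ x → h x ≡ 0) → ∑ xs h ≡ 0
∑-zero []       eq = refl
∑-zero (x ∷ xs) eq = cong₂ _+_ (eq x) (∑-zero xs eq)

∑-const : (xs : List A) (c : ℕ) → ∑[ _ ← xs ] c ≡ length xs * c
∑-const []       c = refl
∑-const (x ∷ xs) c = cong (c +_) (∑-const xs c)

∑-one : (xs : List A) → ∑[ _ ← xs ] 1 ≡ length xs
∑-one xs = trans (∑-const xs 1) (*-identityʳ (length xs))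

∑-distrib-+ : (xs : List A) (g h : A → ℕ) → ∑[ x ← xs ] (g x + h x) ≡ ∑ xs g + ∑ xs h
∑-distrib-+ []       g h = refl
∑-distrib-+ (x ∷ xs) g h = trans (cong (g x + h x +_) (∑-distrib-+ xs g h))
  (interchange +-commutativeSemigroup (g x) (h x) (∑ xs g) (∑ xs h))

∑-*ˡ : (xs : List A) (c : ℕ) (h : A → ℕ) → ∑[ x ← xs ] (c * h x) ≡ c * ∑ xs h
∑-*ˡ []       c h = sym (*-zeroʳ c)
∑-*ˡ (x ∷ xs) c h = trans (cong (c * h x +_) (∑-*ˡ xs c h)) (sym (*-distribˡ-+ c (h x) _))

∑-*ʳ : (xs : List A) (c : ℕ) (h : A → ℕ) → ∑[ x ← xs ] (h x * c) ≡ ∑ xs h * c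
∑-*ʳ xs c h = trans (∑-cong xs (λ x → *-comm (h x) c)) (trans (∑-*ˡ xs c h) (*-comm c _))

∑-comm : (xs : List A) (ys : List B) (h : A → B → ℕ) →
         ∑[ x ← xs ] ∑[ y ← ys ] h x y ≡ ∑[ y ← ys ] ∑[ x ← xs ] h x y
∑-comm []       ys h = sym (∑-zero ys (λ _ → refl))
∑-comm (x ∷ xs) ys h = trans (cong (∑ ys (h x) +_) (∑-comm xs ys h))
  (sym (∑-distrib-+ ys (h x) (λ y → ∑[ x ← xs ] h x y)))

∑-++ : (xs ys : List A) (h : A → ℕ) → ∑ (xs ++ ys) h ≡ ∑ xs h + ∑ ys h
∑-++ xs ys h = trans (cong sum (map-++ h xs ys)) (sum-++ (map h xs) (map h ys))

∏-++ : (xs ys : List A) (h : A → ℕ) → ∏ (xs ++ ys) h ≡ ∏ xs h * ∏ ys h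
∏-++ xs ys h = trans (cong product (map-++ h xs ys)) (product-++ (map h xs) (map h ys))

∑-map : (g : B → A) (ys : List B) (h : A → ℕ) → ∑ (map g ys) h ≡ ∑ ys (h ∘ g)
∑-map g ys h = cong sum (sym (map-∘ ys))

∏-map : (g : B → A) (ys : List B) (h : A → ℕ) → ∏ (map g ys) h ≡ ∏ ys (h ∘ g)
∏-map g ys h = cong product (sym (map-∘ ys))

∑-concatMap : (g : B → List A) (ys : List B) (h : A → ℕ) →
              ∑ (concatMap g ys) h ≡ ∑[ y ← ys ] ∑ (g y) h
∑-concatMap g []       h = refl
∑-concatMap g (y ∷ ys) h = trans (∑-++ (g y) _ h) (cong (∑ (g y) h +_) (∑-concatMap g ys h))

∏-pow : (xs : List A) (a b : ℕ) (g h : A → ℕ) →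
        ∏[ x ← xs ] (a ^ g x * b ^ h x) ≡ a ^ ∑ xs g * b ^ ∑ xs h
∏-pow []       a b g h = refl
∏-pow (x ∷ xs) a b g h = begin
    a ^ g x * b ^ h x * ∏[ x ← xs ] (a ^ g x * b ^ h x)
  ≡⟨ cong (a ^ g x * b ^ h x *_) (∏-pow xs a b g h) ⟩
    a ^ g x * b ^ h x * (a ^ ∑ xs g * b ^ ∑ xs h)
  ≡⟨ [m*n]*[o*p]≡[m*o]*[n*p] (a ^ g x) (b ^ h x) _ _ ⟩
    a ^ g x * a ^ ∑ xs g * (b ^ h x * b ^ ∑ xs h)
  ≡⟨ sym (cong₂ _*_ (^-distribˡ-+-* a (g x) _) (^-distribˡ-+-* b (h x) _)) ⟩
    a ^ (g x + ∑ xs g) * b ^ (h x + ∑ xs h) ∎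
  where open ≡-Reasoning

length-filter : ∀ {p} {P : A → Set p} (P? : ∀ x → Dec (P x)) (xs : List A) →
                length (filter P? xs) ≡ ∑[ x ← xs ] 𝟙 (P? x)
length-filter P? []       = refl
length-filter P? (x ∷ xs) with P? x
... | yes _ = cong suc (length-filter P? xs)
... | no _  = length-filter P? xs

module _ (xs : List A) (ys : List B) where

  ∑-cartesianProduct : (h : A × B → ℕ) →
    ∑ (cartesianProduct xs ys) h ≡ ∑[ x ← xs ] ∑[ y ← ys ] h (x , y)
  ∑-cartesianProduct h = go xs
    where
    go : ∀ xs → ∑ (cartesianProduct xs ys) h ≡ ∑[ x ← xs ] ∑[ y ← ys ] h (x , y)
    go []       = refl
    go (x ∷ xs) = trans (∑-++ (map (x ,_) ys) _ h) (cong₂ _+_ (∑-map (x ,_) ys h) (go xs))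

  ∏-cartesianProduct : (h : A × B → ℕ) →
    ∏ (cartesianProduct xs ys) h ≡ ∏[ x ← xs ] ∏[ y ← ys ] h (x , y)
  ∏-cartesianProduct h = go xs
    where
    go : ∀ xs → ∏ (cartesianProduct xs ys) h ≡ ∏[ x ← xs ] ∏[ y ← ys ] h (x , y)
    go []       = refl
    go (x ∷ xs) = trans (∏-++ (map (x ,_) ys) _ h) (cong₂ _*_ (∏-map (x ,_) ys h) (go xs))

length-allFin : ∀ k → length (allFin k) ≡ k
length-allFin k = length-tabulate {n = k} (λ i → i)

allFin-suc : ∀ k → allFin (suc k) ≡ zero ∷ map suc (allFin k)
allFin-suc k = cong (zero ∷_) (sym (map-tabulate (λ i → i) suc))

-- Enumerations of a decidable setoid

module Enumeration (S : DecSetoid 0ℓ 0ℓ) where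

  open DecSetoid S using (Carrier; _≈_) renaming (_≟_ to _≈?_; sym to ≈-sym; trans to ≈-trans)

  IsEnumeration : List Carrier → Set
  IsEnumeration xs = ∀ x → ∑[ y ← xs ] 𝟙 (y ≈? x) ≡ 1

  record SubsetBijection (P Q : Carrier → Set) : Set where
    field
      to      : Carrier → Carrier
      from    : Carrier → Carrier
      to-cong   : ∀ {x y} → x ≈ y → to x ≈ to y
      from-cong : ∀ {x y} → x ≈ y → from x ≈ from y
      to-∈    : ∀ {x} → P x → Q (to x)
      from-∈  : ∀ {y} → Q y → P (from y)
      from-to : ∀ {x} → P x → from (to x) ≈ x
      to-from : ∀ {y} → Q y → to (from y) ≈ y

  module _ {xs : List Carrier} (enum : IsEnumeration xs) where

    ∈-enumeration : ∀ x → Any (_≈ x) xs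
    ∈-enumeration x = search xs (enum x)
      where
      search : ∀ ys → ∑[ y ← ys ] 𝟙 (y ≈? x) ≡ 1 → Any (_≈ x) ys
      search (y ∷ ys) count with y ≈? x
      ... | yes y≈x = here y≈x
      ... | no _    = there (search ys count)

    count-≈ : ∀ {Q : Carrier → Set} (Q? : ∀ y → Dec (Q y)) x →
              (∀ {y} → Q y → y ≈ x) → (∀ {y} → y ≈ x → Q y) → ∑[ y ← xs ] 𝟙 (Q? y) ≡ 1
    count-≈ Q? x sound complete = trans (∑-cong xs (λ y → 𝟙-⇔ (Q? y) (y ≈? x) sound complete)) (enum x)

    ∑-pick : (H : Carrier → ℕ) → (∀ {x y} → x ≈ y → H x ≡ H y) →
             ∀ z → ∑[ x ← xs ] (𝟙 (z ≈? x) * H x) ≡ H z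
    ∑-pick H H-cong z = begin
        ∑[ x ← xs ] (𝟙 (z ≈? x) * H x)
      ≡⟨ ∑-cong xs (λ x → weight x (z ≈? x)) ⟩
        ∑[ x ← xs ] (𝟙 (z ≈? x) * H z)
      ≡⟨ ∑-*ʳ xs (H z) (λ x → 𝟙 (z ≈? x)) ⟩
        ∑[ x ← xs ] 𝟙 (z ≈? x) * H z
      ≡⟨ cong (_* H z) (count-≈ (z ≈?_) z ≈-sym ≈-sym) ⟩
        1 * H z
      ≡⟨ *-identityˡ (H z) ⟩
        H z ∎
      where
      open ≡-Reasoning
      weight : ∀ x (d : Dec (z ≈ x)) → 𝟙 d * H x ≡ 𝟙 d * H z
      weight x (yes z≈x) = cong (1 *_) (sym (H-cong z≈x))
      weight x (no _)    = refl

    module _ {P Q : Carrier → Set} (P? : ∀ x → Dec (P x)) (Q? : ∀ y → Dec (Q y))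
             (P-resp : ∀ {x y} → x ≈ y → P x → P y) (Q-resp : ∀ {x y} → x ≈ y → Q x → Q y)
             (B : SubsetBijection P Q) where

      open SubsetBijection B

      fibre : ∀ x → ∑[ y ← xs ] 𝟙 (Q? y ×-dec from y ≈? x) ≡ 𝟙 (P? x)
      fibre x with P? x
      ... | yes Px = count-≈ (λ y → Q? y ×-dec from y ≈? x) (to x)
          (λ (Qy , fy≈x) → ≈-trans (≈-sym (to-from Qy)) (to-cong fy≈x))
          (λ y≈tx → Q-resp (≈-sym y≈tx) (to-∈ Px) , ≈-trans (from-cong y≈tx) (from-to Px))
      ... | no ¬Px = ∑-zero xs (λ y → 𝟙-no (Q? y ×-dec from y ≈? x)
          (λ (Qy , fy≈x) → ¬Px (P-resp fy≈x (from-∈ Qy))))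

      ∑-bijection : (H : Carrier → ℕ) → (∀ {x y} → x ≈ y → H x ≡ H y) →
        ∑[ x ← xs ] (𝟙 (P? x) * H x) ≡ ∑[ y ← xs ] (𝟙 (Q? y) * H (from y))
      ∑-bijection H H-cong = sym (begin
          ∑[ y ← xs ] (𝟙 (Q? y) * H (from y))
        ≡⟨ ∑-cong xs (λ y → cong (𝟙 (Q? y) *_) (sym (∑-pick H H-cong (from y)))) ⟩
          ∑[ y ← xs ] (𝟙 (Q? y) * ∑[ x ← xs ] (𝟙 (from y ≈? x) * H x))
        ≡⟨ ∑-cong xs (λ y → trans (sym (∑-*ˡ xs (𝟙 (Q? y)) _))
             (∑-cong xs (λ x → trans (sym (*-assoc (𝟙 (Q? y)) _ (H x)))
               (cong (_* H x) (sym (𝟙-×-dec (Q? y) (from y ≈? x))))))) ⟩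
          ∑[ y ← xs ] ∑[ x ← xs ] (𝟙 (Q? y ×-dec from y ≈? x) * H x)
        ≡⟨ ∑-comm xs xs _ ⟩
          ∑[ x ← xs ] ∑[ y ← xs ] (𝟙 (Q? y ×-dec from y ≈? x) * H x)
        ≡⟨ ∑-cong xs (λ x → trans (∑-*ʳ xs (H x) _) (cong (_* H x) (fibre x))) ⟩
          ∑[ x ← xs ] (𝟙 (P? x) * H x) ∎)
        where open ≡-Reasoning

      count-bijection : ∑[ x ← xs ] 𝟙 (P? x) ≡ ∑[ y ← xs ] 𝟙 (Q? y)
      count-bijection = begin
          ∑[ x ← xs ] 𝟙 (P? x)
        ≡⟨ ∑-cong xs (λ x → sym (*-identityʳ _)) ⟩
          ∑[ x ← xs ] (𝟙 (P? x) * 1)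
        ≡⟨ ∑-bijection (λ _ → 1) (λ _ → refl) ⟩
          ∑[ y ← xs ] (𝟙 (Q? y) * 1)
        ≡⟨ ∑-cong xs (λ y → *-identityʳ _) ⟩
          ∑[ y ← xs ] 𝟙 (Q? y) ∎
        where open ≡-Reasoning

    ∑-reindex : (H : Carrier → ℕ) → (∀ {x y} → x ≈ y → H x ≡ H y) → (ψ π : Carrier → Carrier) →
      (∀ {x y} → x ≈ y → ψ x ≈ ψ y) → (∀ {x y} → x ≈ y → π x ≈ π y) →
      (∀ x → ψ (π x) ≈ x) → (∀ y → π (ψ y) ≈ y) → ∑[ y ← xs ] H (ψ y) ≡ ∑ xs H
    ∑-reindex H H-cong ψ π ψ-cong π-cong ψπ πψ = begin
        ∑[ y ← xs ] H (ψ y)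
      ≡⟨ ∑-cong xs (λ y → sym (*-identityˡ _)) ⟩
        ∑[ y ← xs ] (𝟙 (always y) * H (ψ y))
      ≡⟨ ∑-bijection always always (λ _ _ → tt) (λ _ _ → tt) bijection H H-cong ⟨
        ∑[ x ← xs ] (𝟙 (always x) * H x)
      ≡⟨ ∑-cong xs (λ x → *-identityˡ _) ⟩
        ∑ xs H ∎
      where
      open ≡-Reasoning
      always : ∀ x → Dec (⊤)
      always _ = yes tt
      bijection : SubsetBijection (λ _ → ⊤) (λ _ → ⊤)
      bijection = record { to = π ; from = ψ ; to-cong = π-cong ; from-cong = ψ-cong
        ; to-∈ = λ _ → tt ; from-∈ = λ _ → tt ; from-to = λ {x} _ → ψπ x ; to-from = λ {y} _ → πψ y }

-- Counting tilings cell by cell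

count-allFuns : ∀ {A : Set} (xs : List A) k {P : Fin k → A → Set} (P? : ∀ i a → Dec (P i a)) →
  ∑[ g ← allFuns xs k ] 𝟙 (all? (λ i → P? i (g i))) ≡ ∏[ i ← allFin k ] ∑[ a ← xs ] 𝟙 (P? i a)
count-allFuns xs zero    P? = refl
count-allFuns {A} xs (suc k) P? = begin
    ∑[ g ← allFuns xs (suc k) ] 𝟙 (all? (λ i → P? i (g i)))
  ≡⟨ trans (∑-concatMap _ (allFuns xs k) _)
       (∑-cong (allFuns xs k) (λ g → trans (∑-map _ xs _) (∑-cong xs (λ a → split _)))) ⟩
    ∑[ g ← allFuns xs k ] ∑[ a ← xs ] (𝟙 (P? zero a) * 𝟙 (all? (λ i → P? (suc i) (g i))))
  ≡⟨ ∑-cong (allFuns xs k) (λ g → ∑-*ʳ xs _ (λ a → 𝟙 (P? zero a))) ⟩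
    ∑[ g ← allFuns xs k ] (∑[ a ← xs ] 𝟙 (P? zero a) * 𝟙 (all? (λ i → P? (suc i) (g i))))
  ≡⟨ ∑-*ˡ (allFuns xs k) (∑[ a ← xs ] 𝟙 (P? zero a)) (λ g → 𝟙 (all? (λ i → P? (suc i) (g i)))) ⟩
    ∑[ a ← xs ] 𝟙 (P? zero a) * ∑[ g ← allFuns xs k ] 𝟙 (all? (λ i → P? (suc i) (g i)))
  ≡⟨ cong (∑[ a ← xs ] 𝟙 (P? zero a) *_) (count-allFuns xs k (P? ∘ suc)) ⟩
    ∑[ a ← xs ] 𝟙 (P? zero a) * ∏[ i ← allFin k ] ∑[ a ← xs ] 𝟙 (P? (suc i) a)
  ≡⟨ cong (∑[ a ← xs ] 𝟙 (P? zero a) *_) (∏-map suc (allFin k) _) ⟨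
    ∏[ i ← zero ∷ map suc (allFin k) ] ∑[ a ← xs ] 𝟙 (P? i a)
  ≡⟨ cong (λ is → ∏[ i ← is ] ∑[ a ← xs ] 𝟙 (P? i a)) (allFin-suc k) ⟨
    ∏[ i ← allFin (suc k) ] ∑[ a ← xs ] 𝟙 (P? i a) ∎
  where
  open ≡-Reasoning
  split : (h : Fin (suc k) → A) → 𝟙 (all? (λ i → P? i (h i))) ≡ 𝟙 (P? zero (h zero)) * 𝟙 (all? (λ i → P? (suc i) (h (suc i))))
  split h = trans (𝟙-⇔ (all? (λ i → P? i (h i))) (P? zero (h zero) ×-dec rest)
                       (λ ps → ps zero , ps ∘ suc) (λ { (p , ps) zero → p ; (p , ps) (suc i) → ps i }))
                    (𝟙-×-dec (P? zero (h zero)) rest)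
    where rest = all? (λ i → P? (suc i) (h (suc i)))

allCells : ∀ n → List (Cell n)
allCells n = cartesianProduct (allFin n) (allFin n)

count-allTilings : ∀ n k {P : Cell n → Fin k → Set} (P? : ∀ c a → Dec (P c a))
  {Q : Tiling n k → Set} (Q? : ∀ τ → Dec (Q τ)) →
  (∀ {τ} → Q τ → ∀ c → P c (τ c)) → (∀ {τ} → (∀ c → P c (τ c)) → Q τ) →
  ∑[ τ ← allTilings n k ] 𝟙 (Q? τ) ≡ ∏[ c ← allCells n ] ∑[ a ← allFin k ] 𝟙 (P? c a)
count-allTilings n k {P} P? Q? sound complete = begin
    ∑[ τ ← allTilings n k ] 𝟙 (Q? τ)
  ≡⟨ ∑-map uncurry (allFuns (allFuns (allFin k) n) n) _ ⟩
    ∑[ F ← allFuns (allFuns (allFin k) n) n ] 𝟙 (Q? (uncurry F))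
  ≡⟨ ∑-cong (allFuns (allFuns (allFin k) n) n) (λ F → 𝟙-⇔ (Q? (uncurry F)) (rows F)
       (λ q x y → sound q (x , y)) (λ p → complete (λ (x , y) → p x y))) ⟩
    ∑[ F ← allFuns (allFuns (allFin k) n) n ] 𝟙 (rows F)
  ≡⟨ count-allFuns (allFuns (allFin k) n) n (λ x row → all? (λ y → P? (x , y) (row y))) ⟩
    ∏[ x ← allFin n ] ∑[ row ← allFuns (allFin k) n ] 𝟙 (all? (λ y → P? (x , y) (row y)))
  ≡⟨ ∏-cong (allFin n) (λ x → count-allFuns (allFin k) n (λ y → P? (x , y))) ⟩
    ∏[ x ← allFin n ] ∏[ y ← allFin n ] ∑[ a ← allFin k ] 𝟙 (P? (x , y) a)
  ≡⟨ ∏-cartesianProduct (allFin n) (allFin n) _ ⟨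
    ∏[ c ← allCells n ] ∑[ a ← allFin k ] 𝟙 (P? c a) ∎
  where
  open ≡-Reasoning
  rows : (F : Fin n → Fin n → Fin k) → Dec (∀ x y → P (x , y) (F x y))
  rows F = all? (λ x → all? (λ y → P? (x , y) (F x y)))

finSetoid : ℕ → DecSetoid 0ℓ 0ℓ
finSetoid k = decSetoid (_≟_ {k})

infix 4 _≟ᶜ_
_≟ᶜ_ : ∀ {n} → DecidableEquality (Cell n)
_≟ᶜ_ = ≡-dec _≟_ _≟_

𝟙-≟ᶜ : ∀ {n} (a b x y : Fin n) → 𝟙 ((a , b) ≟ᶜ (x , y)) ≡ 𝟙 (a ≟ x) * 𝟙 (b ≟ y)
𝟙-≟ᶜ a b x y = trans (𝟙-⇔ ((a , b) ≟ᶜ (x , y)) (a ≟ x ×-dec b ≟ y)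
  (λ eq → cong proj₁ eq , cong proj₂ eq) (λ (p , q) → cong₂ _,_ p q)) (𝟙-×-dec (a ≟ x) (b ≟ y))

cellSetoid : ℕ → DecSetoid 0ℓ 0ℓ
cellSetoid n = decSetoid (_≟ᶜ_ {n})

tilingSetoid : ℕ → ℕ → DecSetoid 0ℓ 0ℓ
tilingSetoid n k = record
  { Carrier          = Tiling n k
  ; _≈_              = λ σ τ → ∀ c → σ c ≡ τ c
  ; isDecEquivalence = record
    { isEquivalence = record
      { refl  = λ c → refl
      ; sym   = λ eq c → sym (eq c)
      ; trans = λ eq eq′ c → trans (eq c) (eq′ c) }
    ; _≟_ = λ σ τ → map′ (λ eq (x , y) → eq x y) (λ eq x y → eq (x , y))
                         (all? (λ x → all? (λ y → σ (x , y) ≟ τ (x , y)))) } }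

open Enumeration using (IsEnumeration)

allFin-enumeration : ∀ k → IsEnumeration (finSetoid k) (allFin k)
allFin-enumeration (suc k) b = begin
    ∑[ a ← allFin (suc k) ] 𝟙 (a ≟ b)
  ≡⟨ cong (λ as → ∑[ a ← as ] 𝟙 (a ≟ b)) (allFin-suc k) ⟩
    𝟙 (zero ≟ b) + ∑ (map suc (allFin k)) (λ a → 𝟙 (a ≟ b))
  ≡⟨ cong (𝟙 (zero ≟ b) +_) (∑-map suc (allFin k) _) ⟩
    𝟙 (zero ≟ b) + ∑[ a ← allFin k ] 𝟙 (suc a ≟ b)
  ≡⟨ shift b ⟩
    1 ∎
  where
  open ≡-Reasoning
  shift : ∀ b → 𝟙 (zero ≟ b) + ∑[ a ← allFin k ] 𝟙 (suc a ≟ b) ≡ 1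
  shift zero    = cong suc (∑-zero (allFin k) (λ a → 𝟙-no (suc a ≟ zero) λ ()))
  shift (suc b) = trans (∑-cong (allFin k) (λ a → 𝟙-⇔ (suc a ≟ suc b) (a ≟ b) Fin.suc-injective (cong suc)))
                        (allFin-enumeration k b)

allCells-enumeration : ∀ n → IsEnumeration (cellSetoid n) (allCells n)
allCells-enumeration n (a , b) = begin
    ∑[ c ← allCells n ] 𝟙 (c ≟ᶜ (a , b))
  ≡⟨ ∑-cartesianProduct (allFin n) (allFin n) _ ⟩
    ∑[ x ← allFin n ] ∑[ y ← allFin n ] 𝟙 ((x , y) ≟ᶜ (a , b))
  ≡⟨ ∑-cong (allFin n) (λ x → ∑-cong (allFin n) (λ y → 𝟙-≟ᶜ x y a b)) ⟩
    ∑[ x ← allFin n ] ∑[ y ← allFin n ] (𝟙 (x ≟ a) * 𝟙 (y ≟ b))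
  ≡⟨ ∑-cong (allFin n) (λ x → trans (∑-*ˡ (allFin n) (𝟙 (x ≟ a)) _) (cong (𝟙 (x ≟ a) *_) (allFin-enumeration n b))) ⟩
    ∑[ x ← allFin n ] (𝟙 (x ≟ a) * 1)
  ≡⟨ trans (∑-*ʳ (allFin n) 1 _) (trans (cong (_* 1) (allFin-enumeration n a)) refl) ⟩
    1 ∎
  where open ≡-Reasoning

allTilings-enumeration : ∀ n k → IsEnumeration (tilingSetoid n k) (allTilings n k)
allTilings-enumeration n k τ = trans
  (count-allTilings n k (λ c a → a ≟ τ c) (λ σ → σ ≟ᵗ τ) (λ eq c → eq c) (λ eq c → eq c))
  (∏-one (allCells n) (λ c → allFin-enumeration k (τ c)))
  where open DecSetoid (tilingSetoid n k) using () renaming (_≟_ to _≟ᵗ_)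

-- Orbits of a permutation of finite order

Periodic : {A : Set} → ℕ → (A → A) → Set
Periodic N φ = ∀ x → fold x φ N ≡ x

module _ {A : Set} {N : ℕ} {φ : A → A} (periodic : Periodic N φ) where

  fold-multiple : ∀ q x → fold x φ (q * N) ≡ x
  fold-multiple zero    x = refl
  fold-multiple (suc q) x = trans (fold-+ x φ N) (trans (cong (λ y → fold y φ N) (fold-multiple q x)) (periodic x))

  fold-% : .{{_ : NonZero N}} → ∀ i x → fold x φ (i % N) ≡ fold x φ i
  fold-% i x = sym (begin
      fold x φ i
    ≡⟨ cong (fold x φ) (m≡m%n+[m/n]*n i N) ⟩
      fold x φ (i % N + i / N * N)
    ≡⟨ fold-+ x φ (i % N) ⟩
      fold (fold x φ (i / N * N)) φ (i % N)
    ≡⟨ cong (λ y → fold y φ (i % N)) (fold-multiple (i / N) x) ⟩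
      fold x φ (i % N) ∎)
    where open ≡-Reasoning

NoShortOrbits : {A : Set} → ℕ → (A → A) → Set
NoShortOrbits N s = ∀ c i → 0 < i → i < N → fold c s i ≡ c → s c ≡ c

fold-fixed : {A : Set} {s : A → A} {c : A} → s c ≡ c → ∀ i → fold c s i ≡ c
fold-fixed fx zero    = refl
fold-fixed {s = s} fx (suc i) = trans (cong s (fold-fixed fx i)) fx

module _ {A : Set} (s : A → A) where

  noShortOrbits-1 : NoShortOrbits 1 s
  noShortOrbits-1 c (suc i) _ (s≤s ())

  noShortOrbits-2 : NoShortOrbits 2 s
  noShortOrbits-2 c 1 _ _ eq = eq
  noShortOrbits-2 c (suc (suc i)) _ (s≤s (s≤s ()))

  noShortOrbits-4 : Periodic 4 s → (∀ c → s (s c) ≡ c → s c ≡ c) → NoShortOrbits 4 s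
  noShortOrbits-4 periodic half c 1 _ _ eq = eq
  noShortOrbits-4 periodic half c 2 _ _ eq = half c eq
  noShortOrbits-4 periodic half c 3 _ _ eq = trans (cong s (sym eq)) (periodic c)
  noShortOrbits-4 periodic half c (suc (suc (suc (suc i)))) _ (s≤s (s≤s (s≤s (s≤s ()))))

module _ {A : Set} {P : A → Set} (P? : ∀ x → Dec (P x)) where

  first : (xs : List A) → Any P xs → A
  first (x ∷ xs) a with P? x
  ... | yes _  = x
  ... | no ¬px = first xs (Any.tail ¬px a)

  first-satisfies : ∀ xs a → P (first xs a)
  first-satisfies (x ∷ xs) a with P? x
  ... | yes px = px
  ... | no ¬px = first-satisfies xs (Any.tail ¬px a)

  first-∈ : ∀ xs a → first xs a ∈ₗ xs
  first-∈ (x ∷ xs) a with P? x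
  ... | yes _  = here refl
  ... | no ¬px = there (first-∈ xs (Any.tail ¬px a))

  first-head : ∀ x xs a → P x → first (x ∷ xs) a ≡ x
  first-head x xs a px with P? x
  ... | yes _  = refl
  ... | no ¬px = ⊥-elim (¬px px)

first-cong : {A : Set} {P Q : A → Set} (P? : ∀ x → Dec (P x)) (Q? : ∀ x → Dec (Q x)) →
             (∀ {x} → P x → Q x) → (∀ {x} → Q x → P x) → ∀ xs a b → first P? xs a ≡ first Q? xs b
first-cong P? Q? to from (x ∷ xs) a b with P? x | Q? x
... | yes _  | yes _  = refl
... | yes px | no ¬qx = ⊥-elim (¬qx (to px))
... | no ¬px | yes qx = ⊥-elim (¬px (from qx))
... | no ¬px | no ¬qx = first-cong P? Q? to from xs (Any.tail ¬px a) (Any.tail ¬qx b)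

fold-equivariant : {A B : Set} {s : A → A} {φ : B → B} (τ : A → B) → (∀ c → τ (s c) ≡ φ (τ c)) →
                   ∀ c i → τ (fold c s i) ≡ fold (τ c) φ i
fold-equivariant τ eqv c zero    = refl
fold-equivariant {s = s} {φ} τ eqv c (suc i) = trans (eqv (fold c s i)) (cong φ (fold-equivariant τ eqv c i))


first-upTo-zero : ∀ N {P : ℕ → Set} (P? : ∀ i → Dec (P i)) (a : Any P (upTo N)) → P 0 → first P? (upTo N) a ≡ 0
first-upTo-zero (suc N) P? a p0 = first-head P? 0 _ a p0

suc%-injective : ∀ {N i j} ⦃ _ : NonZero N ⦄ → j < N → suc i < N → suc j % N ≡ suc i → j ≡ i
suc%-injective {N} {i} {j} j<N si<N eq with m<1+n⇒m<n∨m≡n (s<s j<N)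
... | inj₁ sj<N = suc-injective (trans (sym (m<n⇒m%n≡m sj<N)) eq)
... | inj₂ sj≡N = ⊥-elim (0≢1+n (trans (sym (n%n≡0 N)) (trans (cong (_% N) (sym sj≡N)) eq)))

data Kind : Set where
  fixedPt leader follower : Kind

isLeader : Kind → ℕ
isLeader leader = 1
isLeader _      = 0

module Orbits {C : Set} (_≟_ : DecidableEquality C) (elems : List C)
  (enum : Enumeration.IsEnumeration (decSetoid _≟_) elems)
  (s : C → C) (N : ℕ) ⦃ _ : NonZero N ⦄ (periodic : Periodic N s)
  (no-short-orbits : NoShortOrbits N s) where

  open Enumeration (decSetoid _≟_) using (∈-enumeration)

  Orbit : C → C → Set
  Orbit c z = ∃ λ i → fold c s i ≡ z

  orbit? : ∀ c z → Dec (Orbit c z)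
  orbit? c z = map′ (λ (i , eq) → toℕ i , eq)
    (λ (i , eq) → fromℕ< (m%n<n i N) , trans (cong (fold c s) (toℕ-fromℕ< (m%n<n i N))) (trans (fold-% periodic i c) eq))
    (Fin.any? (λ i → fold c s (toℕ i) ≟ z))

  orbit-refl : ∀ c → Orbit c c
  orbit-refl c = 0 , refl

  orbit-trans : ∀ {c d z} → Orbit c d → Orbit d z → Orbit c z
  orbit-trans {c} (i , refl) (j , refl) = j + i , fold-+ c s j

  orbit-sym : ∀ {c d} → Orbit c d → Orbit d c
  orbit-sym {c} (i , refl) = i * N ∸ i , (begin
      fold (fold c s i) s (i * N ∸ i)
    ≡⟨ fold-+ c s (i * N ∸ i) ⟨
      fold c s (i * N ∸ i + i)
    ≡⟨ cong (fold c s) (m∸n+n≡m (m≤m*n i N)) ⟩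
      fold c s (i * N)
    ≡⟨ fold-multiple periodic i c ⟩
      c ∎)
    where open ≡-Reasoning

  s⁻¹ : C → C
  s⁻¹ c = fold c s (pred N)

  s-s⁻¹ : ∀ c → s (s⁻¹ c) ≡ c
  s-s⁻¹ c = trans (cong (fold c s) (suc-pred N)) (periodic c)

  s⁻¹-s : ∀ c → s⁻¹ (s c) ≡ c
  s⁻¹-s c = begin
      fold (s c) s (pred N)
    ≡⟨ fold-+ c s (pred N) ⟨
      fold c s (pred N + 1)
    ≡⟨ cong (fold c s) (trans (+-comm (pred N) 1) (suc-pred N)) ⟩
      fold c s N
    ≡⟨ periodic c ⟩
      c ∎
    where open ≡-Reasoning

  s-injective : ∀ {c d} → s c ≡ s d → c ≡ d
  s-injective {c} {d} eq = trans (sym (s⁻¹-s c)) (trans (cong s⁻¹ eq) (s⁻¹-s d))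

  fixed-orbit : ∀ {c z} → s c ≡ c → Orbit c z → z ≡ c
  fixed-orbit fx (i , refl) = fold-fixed fx i

  rep : C → C
  rep c = first (orbit? c) elems (lose (Any.map sym (∈-enumeration {elems} enum c)) (orbit-refl c))

  rep-orbit : ∀ c → Orbit c (rep c)
  rep-orbit c = first-satisfies (orbit? c) elems _

  rep-cong : ∀ {c d} → Orbit c d → rep d ≡ rep c
  rep-cong c~d = first-cong (orbit? _) (orbit? _) (orbit-trans c~d) (orbit-trans (orbit-sym c~d)) elems _ _

  rep-fixed : ∀ {c} → s c ≡ c → rep c ≡ c
  rep-fixed {c} fx = fixed-orbit fx (rep-orbit c)

  rep-nonfixed : ∀ {c} → ¬ s c ≡ c → ¬ s (rep c) ≡ rep c
  rep-nonfixed {c} nf fx = nf (trans (cong s c≡ρ) (trans fx (sym c≡ρ)))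
    where c≡ρ = fixed-orbit fx (orbit-sym (rep-orbit c))

  steps : C → ℕ
  steps c = first (λ i → fold (rep c) s i ≟ c) (upTo N)
    (lose (∈-upTo⁺ (m%n<n i N)) (trans (fold-% periodic i (rep c)) ρ→c))
    where
    i = proj₁ (orbit-sym (rep-orbit c))
    ρ→c = proj₂ (orbit-sym (rep-orbit c))

  fold-rep-steps : ∀ c → fold (rep c) s (steps c) ≡ c
  fold-rep-steps c = first-satisfies (λ i → fold (rep c) s i ≟ c) (upTo N) _

  steps<N : ∀ c → steps c < N
  steps<N c = ∈-upTo⁻ (first-∈ (λ i → fold (rep c) s i ≟ c) (upTo N) _)

  steps-rep : ∀ {c} → rep c ≡ c → steps c ≡ 0
  steps-rep {c} rep≡c = first-upTo-zero N (λ i → fold (rep c) s i ≟ c) _ rep≡c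

  repeat⇒fixed : ∀ {ρ i j} → i < j → j < N → fold ρ s i ≡ fold ρ s j → s ρ ≡ ρ
  repeat⇒fixed {ρ} {i} {j} i<j j<N eq = trans (cong s ρ≡z) (trans z-fixed (sym ρ≡z))
    where
    z = fold ρ s i
    z-periodic : fold z s (j ∸ i) ≡ z
    z-periodic = trans (sym (fold-+ ρ s (j ∸ i))) (trans (cong (fold ρ s) (m∸n+n≡m (<⇒≤ i<j))) (sym eq))
    z-fixed : s z ≡ z
    z-fixed = no-short-orbits z (j ∸ i) (m<n⇒0<n∸m i<j) (≤-<-trans (m∸n≤m j i) j<N) z-periodic
    ρ≡z : ρ ≡ z
    ρ≡z = fixed-orbit z-fixed (orbit-sym (i , refl))

  index-unique : ∀ {ρ i j} → ¬ s ρ ≡ ρ → i < N → j < N → fold ρ s i ≡ fold ρ s j → i ≡ j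
  index-unique {ρ} {i} {j} nf i<N j<N eq with <-cmp i j
  ... | tri< i<j _ _ = ⊥-elim (nf (repeat⇒fixed i<j j<N eq))
  ... | tri≈ _ i≡j _ = i≡j
  ... | tri> _ _ j<i = ⊥-elim (nf (repeat⇒fixed j<i i<N (sym eq)))

  steps-s : ∀ {c} → ¬ s c ≡ c → steps (s c) ≡ suc (steps c) % N
  steps-s {c} nf = index-unique (rep-nonfixed nf) (steps<N (s c)) (m%n<n (suc (steps c)) N) (begin
      fold (rep c) s (steps (s c))
    ≡⟨ cong (λ ρ → fold ρ s (steps (s c))) (rep-cong (1 , refl)) ⟨
      fold (rep (s c)) s (steps (s c))
    ≡⟨ fold-rep-steps (s c) ⟩
      s c
    ≡⟨ cong s (fold-rep-steps c) ⟨
      fold (rep c) s (suc (steps c))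
    ≡⟨ fold-% periodic (suc (steps c)) (rep c) ⟨
      fold (rep c) s (suc (steps c) % N) ∎)
    where open ≡-Reasoning

  data Classification (c : C) : Kind → Set where
    fixedPt  : s c ≡ c → Classification c fixedPt
    leader   : ¬ s c ≡ c → rep c ≡ c → Classification c leader
    follower : ¬ s c ≡ c → ¬ rep c ≡ c → Classification c follower

  kind : C → Kind
  kind c with s c ≟ c
  ... | yes _ = fixedPt
  ... | no _ with rep c ≟ c
  ...   | yes _ = leader
  ...   | no _  = follower

  classify : ∀ c → Classification c (kind c)
  classify c with s c ≟ c
  ... | yes fx = fixedPt fx
  ... | no nf with rep c ≟ c
  ...   | yes rep≡c  = leader nf rep≡c
  ...   | no ¬rep≡c  = follower nf ¬rep≡c

  fixedPoints freeOrbits : ℕ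
  fixedPoints = ∑[ c ← elems ] 𝟙 (s c ≟ c)
  freeOrbits  = ∑[ c ← elems ] isLeader (kind c)

  private
    nonfixed? : ∀ c → Dec (¬ s c ≡ c)
    nonfixed? c = ¬? (s c ≟ c)

    -- s maps level i onto level i + 1, so every level has as many cells as level 0,
    -- whose cells are the leaders.
    level : ℕ → ℕ
    level i = ∑[ c ← elems ] 𝟙 (nonfixed? c ×-dec steps c ≟ℕ i)

    level-suc : ∀ {i} → suc i < N → level (suc i) ≡ level i
    level-suc {i} si<N = trans
      (sym (∑-reindex {elems} enum (λ c → 𝟙 (nonfixed? c ×-dec steps c ≟ℕ suc i)) (cong _) s s⁻¹ (cong s) (cong s⁻¹) s-s⁻¹ s⁻¹-s))
      (∑-cong elems (λ c → 𝟙-⇔ (nonfixed? (s c) ×-dec steps (s c) ≟ℕ suc i) (nonfixed? c ×-dec steps c ≟ℕ i)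
        (λ (nf , st) → (λ fx → nf (cong s fx)) , suc%-injective (steps<N c) si<N (trans (sym (steps-s (λ fx → nf (cong s fx)))) st))
        (λ (nf , st) → (λ fx → nf (s-injective fx)) , trans (steps-s nf) (trans (cong (λ j → suc j % N) st) (m<n⇒m%n≡m si<N)))))
      where open Enumeration (decSetoid _≟_) using (∑-reindex)

    level-constant : ∀ i → i < N → level i ≡ level 0
    level-constant zero    _    = refl
    level-constant (suc i) si<N = trans (level-suc si<N) (level-constant i (<-trans (n<1+n i) si<N))

    level-0 : level 0 ≡ freeOrbits
    level-0 = ∑-cong elems (λ c → at c (classify c))
      where
      at : ∀ c {κ} → Classification c κ → 𝟙 (nonfixed? c ×-dec steps c ≟ℕ 0) ≡ isLeader κ
      at c (fixedPt fx)     = 𝟙-no _ (λ (nf , _) → nf fx)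
      at c (leader nf rep≡c)    = 𝟙-yes _ (nf , steps-rep rep≡c)
      at c (follower nf ¬rep≡c) = 𝟙-no _ (λ (_ , st) → ¬rep≡c (trans (cong (fold (rep c) s) (sym st)) (fold-rep-steps c)))

    below : ∀ m → m ≤ N → ∑[ c ← elems ] 𝟙 (nonfixed? c ×-dec steps c <? m) ≡ m * freeOrbits
    below zero    _     = ∑-zero elems (λ c → 𝟙-no _ (λ ()))
    below (suc m) sm≤N = begin
        ∑[ c ← elems ] 𝟙 (nonfixed? c ×-dec steps c <? suc m)
      ≡⟨ ∑-cong elems (λ c → 𝟙-⊎ (nonfixed? c ×-dec steps c <? m) (nonfixed? c ×-dec steps c ≟ℕ m) _
           (λ (nf , lt) → Sum.map (nf ,_) (nf ,_) (m<1+n⇒m<n∨m≡n lt))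
           [ (λ (nf , lt) → nf , m<n⇒m<1+n lt) , (λ (nf , eq) → nf , ≤-reflexive (cong suc eq)) ]′
           (λ (_ , lt) (_ , eq) → <-irrefl eq lt)) ⟩
        ∑[ c ← elems ] (𝟙 (nonfixed? c ×-dec steps c <? m) + 𝟙 (nonfixed? c ×-dec steps c ≟ℕ m))
      ≡⟨ ∑-distrib-+ elems _ _ ⟩
        ∑[ c ← elems ] 𝟙 (nonfixed? c ×-dec steps c <? m) + level m
      ≡⟨ cong₂ _+_ (below m (<⇒≤ sm≤N)) (trans (level-constant m sm≤N) level-0) ⟩
        m * freeOrbits + freeOrbits
      ≡⟨ +-comm (m * freeOrbits) freeOrbits ⟩
        suc m * freeOrbits ∎
      where open ≡-Reasoning

  orbit-partition : length elems ≡ fixedPoints + N * freeOrbits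
  orbit-partition = begin
      length elems
    ≡⟨ ∑-one elems ⟨
      ∑[ c ← elems ] 1
    ≡⟨ ∑-cong elems (λ c → 𝟙-¬ (s c ≟ c)) ⟨
      ∑[ c ← elems ] (𝟙 (s c ≟ c) + 𝟙 (nonfixed? c))
    ≡⟨ ∑-distrib-+ elems _ _ ⟩
      fixedPoints + ∑[ c ← elems ] 𝟙 (nonfixed? c)
    ≡⟨ cong (fixedPoints +_) (∑-cong elems (λ c → 𝟙-⇔ (nonfixed? c) (nonfixed? c ×-dec steps c <? N) (_, steps<N c) proj₁)) ⟩
      fixedPoints + ∑[ c ← elems ] 𝟙 (nonfixed? c ×-dec steps c <? N)
    ≡⟨ cong (fixedPoints +_) (below N ≤-refl) ⟩
      fixedPoints + N * freeOrbits ∎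
    where open ≡-Reasoning

-- Equivariant tilings

module EquivariantTilings (n k : ℕ) (s : Cell n → Cell n) (N : ℕ) ⦃ _ : NonZero N ⦄
  (s-periodic : Periodic N s) (no-short-orbits : NoShortOrbits N s)
  (φ : Fin k → Fin k) (φ-periodic : Periodic N φ) where

  open Orbits _≟ᶜ_ (allCells n) (allCells-enumeration n) s N s-periodic no-short-orbits public

  Equivariant : Tiling n k → Set
  Equivariant τ = ∀ c → τ (s c) ≡ φ (τ c)

  fixedTiles : ℕ
  fixedTiles = ∑[ a ← allFin k ] 𝟙 (φ a ≟ a)

  module _ (z : Fin k) where

    -- An equivariant tiling is determined by its tiles on the leaders and the fixed cells;
    -- normalising it by putting z on every follower makes the constraints independent per cell.
    Allowed : Kind → Fin k → Set
    Allowed fixedPt  a = φ a ≡ a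
    Allowed leader   a = ⊤
    Allowed follower a = a ≡ z

    allowed? : ∀ κ a → Dec (Allowed κ a)
    allowed? fixedPt  a = φ a ≟ a
    allowed? leader   a = yes tt
    allowed? follower a = a ≟ z

    Normalised : Tiling n k → Set
    Normalised τ = ∀ c → Allowed (kind c) (τ c)

    normalised? : ∀ τ → Dec (Normalised τ)
    normalised? τ = map′ (λ p (x , y) → p x y) (λ p x y → p (x , y))
      (all? (λ x → all? (λ y → allowed? (kind (x , y)) (τ (x , y)))))

    normalise : Kind → Fin k → Fin k
    normalise follower a = z
    normalise _        a = a

    open Enumeration (tilingSetoid n k) using (SubsetBijection)

    rep-not-follower : ∀ c (a : Fin k) → normalise (kind (rep c)) a ≡ a
    rep-not-follower c a = at (classify (rep c))
      where
      at : ∀ {κ} → Classification (rep c) κ → normalise κ a ≡ a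
      at (fixedPt _)     = refl
      at (leader _ _)    = refl
      at (follower _ ¬rep≡c) = ⊥-elim (¬rep≡c (rep-cong (rep-orbit c)))

    fold-rep-self : ∀ (τ : Tiling n k) {c} → rep c ≡ c → fold (τ (rep c)) φ (steps c) ≡ τ c
    fold-rep-self τ rep≡c = trans (cong (fold _ φ) (steps-rep rep≡c)) (cong τ rep≡c)

    fold-rep-step : ∀ (τ : Tiling n k) {c} → ¬ s c ≡ c →
      fold (τ (rep (s c))) φ (steps (s c)) ≡ φ (fold (τ (rep c)) φ (steps c))
    fold-rep-step τ {c} nf = begin
        fold (τ (rep (s c))) φ (steps (s c))
      ≡⟨ cong₂ (λ ρ i → fold (τ ρ) φ i) (rep-cong (1 , refl)) (steps-s nf) ⟩
        fold (τ (rep c)) φ (suc (steps c) % N)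
      ≡⟨ fold-% φ-periodic (suc (steps c)) (τ (rep c)) ⟩
        φ (fold (τ (rep c)) φ (steps c)) ∎
      where open ≡-Reasoning

    normaliseTiling : Tiling n k → Tiling n k
    normaliseTiling τ c = normalise (kind c) (τ c)

    unfold : Tiling n k → Tiling n k
    unfold τ c = fold (τ (rep c)) φ (steps c)

    normaliseTiling-normalised : ∀ {τ} → Equivariant τ → Normalised (normaliseTiling τ)
    normaliseTiling-normalised {τ} eqv c = at (classify c)
      where
      at : ∀ {κ} → Classification c κ → Allowed κ (normalise κ (τ c))
      at (fixedPt fx)   = trans (sym (eqv c)) (cong τ fx)
      at (leader _ _)   = tt
      at (follower _ _) = refl

    unfold-equivariant : ∀ {τ} → Normalised τ → Equivariant (unfold τ)
    unfold-equivariant {τ} q c = at (classify c) (q c)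
      where
      at : ∀ {κ} → Classification c κ → Allowed κ (τ c) → unfold τ (s c) ≡ φ (unfold τ c)
      at (fixedPt fx) φτ≡τ = begin
          unfold τ (s c)       ≡⟨ cong (unfold τ) fx ⟩
          unfold τ c           ≡⟨ fold-rep-self τ (rep-fixed fx) ⟩
          τ c                  ≡⟨ φτ≡τ ⟨
          φ (τ c)              ≡⟨ cong φ (fold-rep-self τ (rep-fixed fx)) ⟨
          φ (unfold τ c)       ∎
        where open ≡-Reasoning
      at (leader nf _)   _ = fold-rep-step τ nf
      at (follower nf _) _ = fold-rep-step τ nf

    unfold-normaliseTiling : ∀ {τ} → Equivariant τ → ∀ c → unfold (normaliseTiling τ) c ≡ τ c
    unfold-normaliseTiling {τ} eqv c = begin
        fold (normalise (kind (rep c)) (τ (rep c))) φ (steps c)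
      ≡⟨ cong (λ a → fold a φ (steps c)) (rep-not-follower c (τ (rep c))) ⟩
        fold (τ (rep c)) φ (steps c)
      ≡⟨ fold-equivariant τ eqv (rep c) (steps c) ⟨
        τ (fold (rep c) s (steps c))
      ≡⟨ cong τ (fold-rep-steps c) ⟩
        τ c ∎
      where open ≡-Reasoning

    normaliseTiling-unfold : ∀ {τ} → Normalised τ → ∀ c → normaliseTiling (unfold τ) c ≡ τ c
    normaliseTiling-unfold {τ} q c = at (classify c) (q c)
      where
      at : ∀ {κ} → Classification c κ → Allowed κ (τ c) → normalise κ (unfold τ c) ≡ τ c
      at (fixedPt fx)     _   = fold-rep-self τ (rep-fixed fx)
      at (leader _ rep≡c) _   = fold-rep-self τ rep≡c
      at (follower _ _)   τ≡z = sym τ≡z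

    normalisation : SubsetBijection Equivariant Normalised
    normalisation = record
      { to        = normaliseTiling
      ; from      = unfold
      ; to-cong   = λ eq c → cong (normalise (kind c)) (eq c)
      ; from-cong = λ eq c → cong (λ a → fold a φ (steps c)) (eq (rep c))
      ; to-∈      = normaliseTiling-normalised
      ; from-∈    = unfold-equivariant
      ; from-to   = unfold-normaliseTiling
      ; to-from   = normaliseTiling-unfold }

    allowed-count : ∀ c → ∑[ a ← allFin k ] 𝟙 (allowed? (kind c) a) ≡ k ^ isLeader (kind c) * fixedTiles ^ 𝟙 (s c ≟ᶜ c)
    allowed-count c = at (classify c)
      where
      at : ∀ {κ} → Classification c κ → ∑[ a ← allFin k ] 𝟙 (allowed? κ a) ≡ k ^ isLeader κ * fixedTiles ^ 𝟙 (s c ≟ᶜ c)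
      at (fixedPt fx) = sym (trans (cong (λ j → 1 * fixedTiles ^ j) (𝟙-yes (s c ≟ᶜ c) fx))
                                   (trans (*-identityˡ _) (*-identityʳ fixedTiles)))
      at (leader nf _) = begin
          ∑[ a ← allFin k ] 1                 ≡⟨ ∑-one (allFin k) ⟩
          length (allFin k)                   ≡⟨ length-allFin k ⟩
          k                                   ≡⟨ *-identityʳ k ⟨
          k * 1                               ≡⟨ *-identityʳ (k * 1) ⟨
          k ^ 1 * 1                           ≡⟨ cong (λ j → k ^ 1 * fixedTiles ^ j) (𝟙-no (s c ≟ᶜ c) nf) ⟨
          k ^ 1 * fixedTiles ^ 𝟙 (s c ≟ᶜ c)   ∎
        where open ≡-Reasoning
      at (follower nf _) = trans (allFin-enumeration k z) (cong (λ j → 1 * fixedTiles ^ j) (sym (𝟙-no (s c ≟ᶜ c) nf)))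

    count-equivariant : (E? : ∀ τ → Dec (Equivariant τ)) →
      ∑[ τ ← allTilings n k ] 𝟙 (E? τ) ≡ k ^ freeOrbits * fixedTiles ^ fixedPoints
    count-equivariant E? = begin
        ∑[ τ ← allTilings n k ] 𝟙 (E? τ)
      ≡⟨ count-bijection {allTilings n k} (allTilings-enumeration n k) E? normalised?
           (λ eq eqv c → trans (sym (eq (s c))) (trans (eqv c) (cong φ (eq c))))
           (λ eq q c → subst (Allowed (kind c)) (eq c) (q c))
           normalisation ⟩
        ∑[ τ ← allTilings n k ] 𝟙 (normalised? τ)
      ≡⟨ count-allTilings n k (λ c → allowed? (kind c)) normalised? (λ q → q) (λ q → q) ⟩
        ∏[ c ← allCells n ] ∑[ a ← allFin k ] 𝟙 (allowed? (kind c) a)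
      ≡⟨ ∏-cong (allCells n) allowed-count ⟩
        ∏[ c ← allCells n ] (k ^ isLeader (kind c) * fixedTiles ^ 𝟙 (s c ≟ᶜ c))
      ≡⟨ ∏-pow (allCells n) k fixedTiles _ _ ⟩
        k ^ freeOrbits * fixedTiles ^ fixedPoints ∎
      where
      open ≡-Reasoning
      open Enumeration (tilingSetoid n k) using (count-bijection)

-- The dihedral group

everyD8 : (P : D8 → Set) → P e → P r → P r² → P r³ → P f → P rf → P r²f → P r³f → ∀ g → P g
everyD8 P pe pr pr² pr³ pf prf pr²f pr³f = λ where
  e → pe ; r → pr ; r² → pr² ; r³ → pr³ ; f → pf ; rf → prf ; r²f → pr²f ; r³f → pr³f

inv-·-cancel : ∀ g h → inv g · (g · h) ≡ h
inv-·-cancel = everyD8 _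
  (everyD8 _ refl refl refl refl refl refl refl refl) (everyD8 _ refl refl refl refl refl refl refl refl)
  (everyD8 _ refl refl refl refl refl refl refl refl) (everyD8 _ refl refl refl refl refl refl refl refl)
  (everyD8 _ refl refl refl refl refl refl refl refl) (everyD8 _ refl refl refl refl refl refl refl refl)
  (everyD8 _ refl refl refl refl refl refl refl refl) (everyD8 _ refl refl refl refl refl refl refl refl)

·-inv-cancel : ∀ g h → g · (inv g · h) ≡ h
·-inv-cancel = everyD8 _
  (everyD8 _ refl refl refl refl refl refl refl refl) (everyD8 _ refl refl refl refl refl refl refl refl)
  (everyD8 _ refl refl refl refl refl refl refl refl) (everyD8 _ refl refl refl refl refl refl refl refl)
  (everyD8 _ refl refl refl refl refl refl refl refl) (everyD8 _ refl refl refl refl refl refl refl refl)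
  (everyD8 _ refl refl refl refl refl refl refl refl) (everyD8 _ refl refl refl refl refl refl refl refl)

inv-· : ∀ g → inv g · g ≡ e
inv-· = everyD8 _ refl refl refl refl refl refl refl refl

·-inv : ∀ g → g · inv g ≡ e
·-inv = everyD8 _ refl refl refl refl refl refl refl refl

toFin : D8 → Fin 8
toFin e   = zero
toFin r   = suc zero
toFin r²  = suc (suc zero)
toFin r³  = suc (suc (suc zero))
toFin f   = suc (suc (suc (suc zero)))
toFin rf  = suc (suc (suc (suc (suc zero))))
toFin r²f = suc (suc (suc (suc (suc (suc zero)))))
toFin r³f = suc (suc (suc (suc (suc (suc (suc zero))))))

fromFin : Fin 8 → D8
fromFin zero                                      = e
fromFin (suc zero)                                = r
fromFin (suc (suc zero))                          = r²
fromFin (suc (suc (suc zero)))                    = r³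
fromFin (suc (suc (suc (suc zero))))              = f
fromFin (suc (suc (suc (suc (suc zero)))))        = rf
fromFin (suc (suc (suc (suc (suc (suc zero))))))  = r²f
fromFin (suc (suc (suc (suc (suc (suc (suc _))))))) = r³f

fromFin-toFin : ∀ g → fromFin (toFin g) ≡ g
fromFin-toFin = everyD8 _ refl refl refl refl refl refl refl refl

_≟ᴰ_ : DecidableEquality D8
g ≟ᴰ h = map′ (λ eq → trans (sym (fromFin-toFin g)) (trans (cong fromFin eq) (fromFin-toFin h)))
              (cong toFin) (toFin g ≟ toFin h)

⊙-· : ∀ {n} (c : Cell n) g h → c ⊙ (g · h) ≡ c ⊙ g ⊙ h
⊙-· (x , y) e e = refl
⊙-· (x , y) e r = refl
⊙-· (x , y) e r² = refl
⊙-· (x , y) e r³ = refl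
⊙-· (x , y) e f = refl
⊙-· (x , y) e rf = refl
⊙-· (x , y) e r²f = refl
⊙-· (x , y) e r³f = refl
⊙-· (x , y) r e = refl
⊙-· (x , y) r r = refl
⊙-· (x , y) r r² = cong₂ _,_ (sym (opposite-involutive y)) refl
⊙-· (x , y) r r³ = cong₂ _,_ refl (sym (opposite-involutive y))
⊙-· (x , y) r f = cong₂ _,_ (sym (opposite-involutive y)) refl
⊙-· (x , y) r rf = refl
⊙-· (x , y) r r²f = refl
⊙-· (x , y) r r³f = cong₂ _,_ refl (sym (opposite-involutive y))
⊙-· (x , y) r² e = refl
⊙-· (x , y) r² r = cong₂ _,_ (sym (opposite-involutive y)) refl
⊙-· (x , y) r² r² = cong₂ _,_ (sym (opposite-involutive x)) (sym (opposite-involutive y))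
⊙-· (x , y) r² r³ = cong₂ _,_ refl (sym (opposite-involutive x))
⊙-· (x , y) r² f = cong₂ _,_ (sym (opposite-involutive x)) refl
⊙-· (x , y) r² rf = refl
⊙-· (x , y) r² r²f = cong₂ _,_ refl (sym (opposite-involutive y))
⊙-· (x , y) r² r³f = cong₂ _,_ (sym (opposite-involutive y)) (sym (opposite-involutive x))
⊙-· (x , y) r³ e = refl
⊙-· (x , y) r³ r = cong₂ _,_ (sym (opposite-involutive x)) refl
⊙-· (x , y) r³ r² = cong₂ _,_ refl (sym (opposite-involutive x))
⊙-· (x , y) r³ r³ = refl
⊙-· (x , y) r³ f = refl
⊙-· (x , y) r³ rf = refl
⊙-· (x , y) r³ r²f = cong₂ _,_ refl (sym (opposite-involutive x))
⊙-· (x , y) r³ r³f = cong₂ _,_ (sym (opposite-involutive x)) refl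
⊙-· (x , y) f e = refl
⊙-· (x , y) f r = refl
⊙-· (x , y) f r² = cong₂ _,_ (sym (opposite-involutive x)) refl
⊙-· (x , y) f r³ = cong₂ _,_ refl (sym (opposite-involutive x))
⊙-· (x , y) f f = cong₂ _,_ (sym (opposite-involutive x)) refl
⊙-· (x , y) f rf = refl
⊙-· (x , y) f r²f = refl
⊙-· (x , y) f r³f = cong₂ _,_ refl (sym (opposite-involutive x))
⊙-· (x , y) rf e = refl
⊙-· (x , y) rf r = refl
⊙-· (x , y) rf r² = refl
⊙-· (x , y) rf r³ = refl
⊙-· (x , y) rf f = refl
⊙-· (x , y) rf rf = refl
⊙-· (x , y) rf r²f = refl
⊙-· (x , y) rf r³f = refl
⊙-· (x , y) r²f e = refl
⊙-· (x , y) r²f r = cong₂ _,_ (sym (opposite-involutive y)) refl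
⊙-· (x , y) r²f r² = cong₂ _,_ refl (sym (opposite-involutive y))
⊙-· (x , y) r²f r³ = refl
⊙-· (x , y) r²f f = refl
⊙-· (x , y) r²f rf = refl
⊙-· (x , y) r²f r²f = cong₂ _,_ refl (sym (opposite-involutive y))
⊙-· (x , y) r²f r³f = cong₂ _,_ (sym (opposite-involutive y)) refl
⊙-· (x , y) r³f e = refl
⊙-· (x , y) r³f r = cong₂ _,_ (sym (opposite-involutive x)) refl
⊙-· (x , y) r³f r² = cong₂ _,_ (sym (opposite-involutive y)) (sym (opposite-involutive x))
⊙-· (x , y) r³f r³ = cong₂ _,_ refl (sym (opposite-involutive y))
⊙-· (x , y) r³f f = cong₂ _,_ (sym (opposite-involutive y)) refl
⊙-· (x , y) r³f rf = refl
⊙-· (x , y) r³f r²f = cong₂ _,_ refl (sym (opposite-involutive x))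
⊙-· (x , y) r³f r³f = cong₂ _,_ (sym (opposite-involutive x)) (sym (opposite-involutive y))

⊙-e : ∀ {n} (c : Cell n) → c ⊙ e ≡ c
⊙-e c = refl

infixl 30 _^ᴰ_
_^ᴰ_ : D8 → ℕ → D8
g ^ᴰ zero  = e
g ^ᴰ suc i = g ^ᴰ i · g

fold-⊙ : ∀ {n} (c : Cell n) g i → fold c (_⊙ g) i ≡ c ⊙ g ^ᴰ i
fold-⊙ c g zero    = refl
fold-⊙ c g (suc i) = trans (cong (_⊙ g) (fold-⊙ c g i)) (sym (⊙-· c (g ^ᴰ i) g))

⊙-periodic : ∀ {n} g N → g ^ᴰ N ≡ e → Periodic N (λ (c : Cell n) → c ⊙ g)
⊙-periodic g N gᴺ≡e c = trans (fold-⊙ c g N) (trans (cong (c ⊙_) gᴺ≡e) (⊙-e c))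

module _ {R : Subgroup} (T' : TileSet R) where

  mem-^ : ∀ {g} → g ∈ R → ∀ i → g ^ᴰ i ∈ R
  mem-^ p zero    = mem-e R
  mem-^ p (suc i) = mem-· R (mem-^ p i) p

  act-cong : ∀ d {g h} → g ≡ h → (p : g ∈ R) (q : h ∈ R) → act T' d g p ≡ act T' d h q
  act-cong d refl p q = cong (act T' d _) (T-irrelevant p q)

  fold-act : ∀ {g} (p : g ∈ R) d i → fold d (λ a → act T' a g p) i ≡ act T' d (g ^ᴰ i) (mem-^ p i)
  fold-act p d zero    = sym (act-e T' d)
  fold-act p d (suc i) = trans (cong (λ a → act T' a _ p) (fold-act p d i)) (act-· T' d (mem-^ p i) p)

⊙-·-inv : ∀ {n} (c : Cell n) g → c ⊙ g ⊙ inv g ≡ c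
⊙-·-inv c g = trans (sym (⊙-· c g (inv g))) (trans (cong (c ⊙_) (·-inv g)) (⊙-e c))

⊙-inv-· : ∀ {n} (c : Cell n) g → c ⊙ inv g ⊙ g ≡ c
⊙-inv-· c g = trans (sym (⊙-· c (inv g) g)) (trans (cong (c ⊙_) (inv-· g)) (⊙-e c))

allD8-enumeration : Enumeration.IsEnumeration (decSetoid _≟ᴰ_) allD8
allD8-enumeration = everyD8 _ refl refl refl refl refl refl refl refl

-- Tilings fixed by one symmetry

cell-count : ∀ n → length (allCells n) ≡ n * n
cell-count n = begin
    length (allCells n)
  ≡⟨ ∑-one (allCells n) ⟨
    ∑[ c ← allCells n ] 1
  ≡⟨ ∑-cartesianProduct (allFin n) (allFin n) _ ⟩
    ∑[ x ← allFin n ] ∑[ y ← allFin n ] 1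
  ≡⟨ ∑-cong (allFin n) (λ x → ∑-one (allFin n)) ⟩
    ∑[ x ← allFin n ] length (allFin n)
  ≡⟨ ∑-const (allFin n) (length (allFin n)) ⟩
    length (allFin n) * length (allFin n)
  ≡⟨ cong (λ l → l * l) (length-allFin n) ⟩
    n * n ∎
  where open ≡-Reasoning

zero-power : ∀ a b → 0 < a + b → 0 ^ a * 0 ^ b ≡ 0
zero-power (suc a) b       _ = refl
zero-power zero    (suc b) _ = refl

fixedCells : ℕ → D8 → ℕ
fixedCells n g = ∑[ c ← allCells n ] 𝟙 (c ⊙ g ≟ᶜ c)

module _ {R : Subgroup} (T' : TileSet R) where

  tcount-e : tcount T' e (mem-e R) ≡ m T'
  tcount-e = begin
      tcount T' e (mem-e R)
    ≡⟨ length-filter (λ d → act T' d e (mem-e R) ≟ d) (allFin (m T')) ⟩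
      ∑[ d ← allFin (m T') ] 𝟙 (act T' d e (mem-e R) ≟ d)
    ≡⟨ ∑-cong (allFin (m T')) (λ d → 𝟙-yes (act T' d e (mem-e R) ≟ d) (act-e T' d)) ⟩
      ∑[ d ← allFin (m T') ] 1
    ≡⟨ ∑-one (allFin (m T')) ⟩
      length (allFin (m T'))
    ≡⟨ length-allFin (m T') ⟩
      m T' ∎
    where open ≡-Reasoning

  module FixedTilings {n} (1≤n : 1 ≤ n) g (p : g ∈ R) N ⦃ _ : NonZero N ⦄ (gᴺ≡e : g ^ᴰ N ≡ e)
    (no-short-orbits : NoShortOrbits N (λ (c : Cell n) → c ⊙ g)) where

    open EquivariantTilings n (m T') (_⊙ g) N (⊙-periodic g N gᴺ≡e) no-short-orbits (λ d → act T' d g p)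
      (λ d → trans (fold-act T' p d N) (trans (act-cong T' d gᴺ≡e _ (mem-e R)) (act-e T' d))) public

    partition : n * n ≡ fixedPoints + N * freeOrbits
    partition = trans (sym (cell-count n)) orbit-partition

    freeOrbits≡ : (n * n ∸ fixedPoints) / N ≡ freeOrbits
    freeOrbits≡ = begin
        (n * n ∸ fixedPoints) / N
      ≡⟨ cong (λ x → (x ∸ fixedPoints) / N) partition ⟩
        (fixedPoints + N * freeOrbits ∸ fixedPoints) / N
      ≡⟨ cong (_/ N) (trans (m+n∸m≡n fixedPoints (N * freeOrbits)) (*-comm N freeOrbits)) ⟩
        freeOrbits * N / N
      ≡⟨ m*n/n≡m freeOrbits N ⟩
        freeOrbits ∎
      where open ≡-Reasoning

    nonempty : 0 < freeOrbits + fixedPoints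
    nonempty = positive freeOrbits (subst (0 <_) partition (*-mono-≤ 1≤n 1≤n))
      where
      positive : ∀ L → 0 < fixedPoints + N * L → 0 < L + fixedPoints
      positive (suc L) _ = s≤s z≤n
      positive zero    h = subst (0 <_) (trans (cong (fixedPoints +_) (*-zeroʳ N)) (+-identityʳ fixedPoints)) h

    count-fixed : ∀ k → k ≡ m T' → ∑[ τ ← allTilings n (m T') ] 𝟙 (fixedBy? T' τ g p) ≡ m T' ^ freeOrbits * fixedTiles ^ fixedPoints
    count-fixed (suc _) eq = count-equivariant (subst Fin eq zero) (λ τ → fixedBy? T' τ g p)
    count-fixed zero    eq = begin
        ∑[ τ ← allTilings n (m T') ] 𝟙 (fixedBy? T' τ g p)
      ≡⟨ ∑-zero (allTilings n (m T')) (λ τ → ⊥-elim (no-tiles (τ (fromℕ< 1≤n , fromℕ< 1≤n)))) ⟩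
        0
      ≡⟨ zero-power freeOrbits fixedPoints nonempty ⟨
        0 ^ freeOrbits * 0 ^ fixedPoints
      ≡⟨ cong₂ (λ a b → a ^ freeOrbits * b ^ fixedPoints) eq (sym (∑-zero (allFin (m T')) (⊥-elim ∘ no-tiles))) ⟩
        m T' ^ freeOrbits * fixedTiles ^ fixedPoints ∎
      where
      open ≡-Reasoning
      no-tiles : Fin (m T') → ⊥
      no-tiles d with subst Fin (sym eq) d
      ... | ()

  fix-formula : ∀ {n} → 1 ≤ n → ∀ g (p : g ∈ R) N ⦃ _ : NonZero N ⦄ → g ^ᴰ N ≡ e →
    NoShortOrbits N (λ (c : Cell n) → c ⊙ g) → ∀ {F} → fixedCells n g ≡ F →
    Fix T' n g p ≡ tcount T' e (mem-e R) ^ ((n * n ∸ F) / N) * tcount T' g p ^ F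
  fix-formula {n} 1≤n g p N gᴺ≡e no-short-orbits refl = begin
      Fix T' n g p
    ≡⟨ length-filter (λ τ → fixedBy? T' τ g p) (allTilings n (m T')) ⟩
      ∑[ τ ← allTilings n (m T') ] 𝟙 (fixedBy? T' τ g p)
    ≡⟨ count-fixed (m T') refl ⟩
      m T' ^ freeOrbits * fixedTiles ^ fixedPoints
    ≡⟨ cong₂ (λ a b → a ^ b * fixedTiles ^ fixedPoints) (sym tcount-e) (sym freeOrbits≡) ⟩
      tcount T' e (mem-e R) ^ ((n * n ∸ fixedPoints) / N) * fixedTiles ^ fixedPoints
    ≡⟨ cong (λ t → tcount T' e (mem-e R) ^ ((n * n ∸ fixedPoints) / N) * t ^ fixedPoints)
         (length-filter (λ d → act T' d g p ≟ d) (allFin (m T'))) ⟨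
      tcount T' e (mem-e R) ^ ((n * n ∸ fixedPoints) / N) * tcount T' g p ^ fixedPoints ∎
    where
    open ≡-Reasoning
    open FixedTilings 1≤n g p N gᴺ≡e no-short-orbits

-- Cells fixed by each symmetry

centres : ℕ → ℕ
centres n = ∑[ x ← allFin n ] 𝟙 (opposite x ≟ x)

module _ {n : ℕ} where

  private
    double : ∀ a → a + a ≡ a * 2
    double a = sym (trans (*-comm a 2) (cong (a +_) (+-identityʳ a)))

  centre⇒ : (x : Fin n) → opposite x ≡ x → suc (toℕ x * 2) ≡ n
  centre⇒ x eq = begin
      suc (toℕ x * 2)
    ≡⟨ cong suc (double (toℕ x)) ⟨
      suc (toℕ x + toℕ x)
    ≡⟨ +-suc (toℕ x) (toℕ x) ⟨
      toℕ x + suc (toℕ x)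
    ≡⟨ cong (λ y → toℕ y + suc (toℕ x)) eq ⟨
      toℕ (opposite x) + suc (toℕ x)
    ≡⟨ cong (_+ suc (toℕ x)) (opposite-prop x) ⟩
      n ∸ suc (toℕ x) + suc (toℕ x)
    ≡⟨ m∸n+n≡m (toℕ<n x) ⟩
      n ∎
    where open ≡-Reasoning

  centre⇐ : (x : Fin n) → suc (toℕ x * 2) ≡ n → opposite x ≡ x
  centre⇐ x eq = toℕ-injective (begin
      toℕ (opposite x)
    ≡⟨ opposite-prop x ⟩
      n ∸ suc (toℕ x)
    ≡⟨ cong (_∸ suc (toℕ x)) eq ⟨
      toℕ x * 2 ∸ toℕ x
    ≡⟨ cong (_∸ toℕ x) (double (toℕ x)) ⟨
      toℕ x + toℕ x ∸ toℕ x
    ≡⟨ m+n∸n≡m (toℕ x) (toℕ x) ⟩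
      toℕ x ∎)
    where open ≡-Reasoning

  centre-unique : ∀ {x y : Fin n} → opposite x ≡ x → opposite y ≡ y → x ≡ y
  centre-unique {x} {y} ox oy =
    toℕ-injective (*-cancelʳ-≡ (toℕ x) (toℕ y) 2 (suc-injective (trans (centre⇒ x ox) (sym (centre⇒ y oy)))))

  centre⇒odd : ∀ {x : Fin n} → opposite x ≡ x → n % 2 ≡ 1
  centre⇒odd {x} ox = trans (cong (_% 2) (sym (centre⇒ x ox))) ([m+kn]%n≡m%n 1 (toℕ x) 2)

  r²-fixed⇒r-fixed : ∀ (c : Cell n) → c ⊙ r² ≡ c → c ⊙ r ≡ c
  r²-fixed⇒r-fixed (x , y) eq = cong₂ _,_ (trans (cong proj₂ eq) (sym x≡y)) x≡y
    where x≡y = centre-unique (cong proj₁ eq) (cong proj₂ eq)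

  r²-fixed⇒r³-fixed : ∀ (c : Cell n) → c ⊙ r² ≡ c → c ⊙ r³ ≡ c
  r²-fixed⇒r³-fixed (x , y) eq = cong₂ _,_ (sym x≡y) (trans (cong proj₁ eq) x≡y)
    where x≡y = centre-unique (cong proj₁ eq) (cong proj₂ eq)

  centres-even : n % 2 ≡ 0 → centres n ≡ 0
  centres-even even = ∑-zero (allFin n) (λ x → 𝟙-no (opposite x ≟ x) (λ ox → 0≢1+n (trans (sym even) (centre⇒odd ox))))

  centres-odd : n % 2 ≡ 1 → centres n ≡ 1
  centres-odd odd = Enumeration.count-≈ (finSetoid n) {allFin n} (allFin-enumeration n) (λ x → opposite x ≟ x) middle
    (λ ox → centre-unique ox middle-centre) (λ { refl → middle-centre })
    where
    n≡ : n ≡ suc (n / 2 * 2)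
    n≡ = trans (m≡m%n+[m/n]*n n 2) (cong (_+ n / 2 * 2) odd)
    half<n : n / 2 < n
    half<n = subst (n / 2 <_) (sym n≡) (s≤s (subst (n / 2 ≤_) (double (n / 2)) (m≤m+n (n / 2) (n / 2))))
    middle : Fin n
    middle = fromℕ< half<n
    middle-centre : opposite middle ≡ middle
    middle-centre = centre⇐ middle (trans (cong (λ a → suc (a * 2)) (toℕ-fromℕ< half<n)) (sym n≡))

module _ (n : ℕ) where

  private
    C : Fin n → ℕ
    C x = 𝟙 (opposite x ≟ x)

    𝟙-refl : ∀ (x : Fin n) → 𝟙 (x ≟ x) ≡ 1
    𝟙-refl x = 𝟙-yes (x ≟ x) refl

    grid : ∀ g {h : Fin n → Fin n → ℕ} → (∀ x y → 𝟙 ((x , y) ⊙ g ≟ᶜ (x , y)) ≡ h x y) →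
           fixedCells n g ≡ ∑[ x ← allFin n ] ∑[ y ← allFin n ] h x y
    grid g eq = trans (∑-cartesianProduct (allFin n) (allFin n) _)
                      (∑-cong (allFin n) (λ x → ∑-cong (allFin n) (eq x)))

    ∑-row : (h : Fin n → ℕ) → ∑[ x ← allFin n ] ∑[ y ← allFin n ] h x ≡ n * ∑[ x ← allFin n ] h x
    ∑-row h = trans (∑-cong (allFin n) (λ x → trans (∑-const (allFin n) (h x)) (cong (_* h x) (length-allFin n))))
                    (∑-*ˡ (allFin n) n h)

    ∑-diagonal : (σ : Fin n → Fin n) → ∑[ x ← allFin n ] ∑[ y ← allFin n ] 𝟙 (y ≟ σ x) ≡ n
    ∑-diagonal σ = trans (∑-cong (allFin n) (λ x → allFin-enumeration n (σ x))) (trans (∑-one (allFin n)) (length-allFin n))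

  fixedCells-e : fixedCells n e ≡ n * n
  fixedCells-e = trans (∑-cong (allCells n) (λ c → 𝟙-yes (c ⊙ e ≟ᶜ c) refl)) (trans (∑-one (allCells n)) (cell-count n))

  fixedCells-r² : fixedCells n r² ≡ centres n * centres n
  fixedCells-r² = trans (grid r² (λ x y → 𝟙-≟ᶜ (opposite x) (opposite y) x y))
    (trans (∑-cong (allFin n) (λ x → ∑-*ˡ (allFin n) (C x) C)) (∑-*ʳ (allFin n) (centres n) C))

  fixedCells-r : fixedCells n r ≡ centres n * centres n
  fixedCells-r = trans (∑-cong (allCells n) (λ c → 𝟙-⇔ (c ⊙ r ≟ᶜ c) (c ⊙ r² ≟ᶜ c)
      (λ eq → trans (⊙-· c r r) (trans (cong (_⊙ r) eq) eq)) (r²-fixed⇒r-fixed c)))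
    fixedCells-r²

  fixedCells-r³ : fixedCells n r³ ≡ centres n * centres n
  fixedCells-r³ = trans (∑-cong (allCells n) (λ c → 𝟙-⇔ (c ⊙ r³ ≟ᶜ c) (c ⊙ r² ≟ᶜ c)
      (λ eq → trans (⊙-· c r³ r³) (trans (cong (_⊙ r³) eq) eq)) (r²-fixed⇒r³-fixed c)))
    fixedCells-r²

  fixedCells-f : fixedCells n f ≡ n * centres n
  fixedCells-f = trans (grid f (λ x y → trans (𝟙-≟ᶜ (opposite x) y x y) (trans (cong (C x *_) (𝟙-refl y)) (*-identityʳ (C x)))))
    (∑-row C)

  fixedCells-r²f : fixedCells n r²f ≡ n * centres n
  fixedCells-r²f = trans (grid r²f (λ x y → trans (𝟙-≟ᶜ x (opposite y) x y) (trans (cong (_* C y) (𝟙-refl x)) (+-identityʳ (C y)))))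
    (trans (∑-const (allFin n) (centres n)) (cong (_* centres n) (length-allFin n)))

  fixedCells-rf : fixedCells n rf ≡ n
  fixedCells-rf = trans (grid rf (λ x y → 𝟙-⇔ ((y , x) ≟ᶜ (x , y)) (y ≟ x) (cong proj₁) (λ { refl → refl }))) (∑-diagonal (λ x → x))

  fixedCells-r³f : fixedCells n r³f ≡ n
  fixedCells-r³f = trans (grid r³f (λ x y → 𝟙-⇔ ((opposite y , opposite x) ≟ᶜ (x , y)) (y ≟ opposite x)
      (λ eq → sym (cong proj₂ eq))
      (λ { refl → cong₂ _,_ (opposite-involutive x) refl })))
    (∑-diagonal opposite)

-- Burnside's lemma

ifIn-cong : ∀ {b b'} {F : T b → ℕ} {F' : T b' → ℕ} → (T b → T b') → (T b' → T b) →
            (∀ p p' → F p ≡ F' p') → ifIn b F ≡ ifIn b' F'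
ifIn-cong {true}  {true}  to from eq = eq tt tt
ifIn-cong {true}  {false} to from eq = ⊥-elim (to tt)
ifIn-cong {false} {true}  to from eq = ⊥-elim (from tt)
ifIn-cong {false} {false} to from eq = refl

ifIn-∑ : ∀ {A : Set} b (xs : List A) (h : T b → A → ℕ) →
         ifIn b (λ p → ∑ xs (h p)) ≡ ∑[ x ← xs ] ifIn b (λ p → h p x)
ifIn-∑ true  xs h = refl
ifIn-∑ false xs h = sym (∑-zero xs (λ _ → refl))

module _ {A : Set} {Q : A → Set} {_∼_ : A → A → Set} (Q? : ∀ x → Dec (Q x))
         (exclusive : ∀ {x y} → Q x → Q y → ¬ x ∼ y) where

  private
    none : ∀ {x ys} → Q x → All (x ∼_) ys → ∑[ y ← ys ] 𝟙 (Q? y) ≡ 0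
    none qx []           = refl
    none qx (x∼y ∷ x∼ys) = cong₂ _+_ (𝟙-no (Q? _) (λ qy → exclusive qx qy x∼y)) (none qx x∼ys)

    clash : ∀ {x ys} → Q x → All (x ∼_) ys → ¬ Any Q ys
    clash qx (x∼y ∷ _)    (here qy) = exclusive qx qy x∼y
    clash qx (_ ∷ x∼ys)   (there q) = clash qx x∼ys q

  count-unique : ∀ {xs} → AllPairs _∼_ xs → Any Q xs → ∑[ x ← xs ] 𝟙 (Q? x) ≡ 1
  count-unique (x∼xs ∷ _)        (here qx) = cong₂ _+_ (𝟙-yes (Q? _) qx) (none qx x∼xs)
  count-unique (x∼xs ∷ distinct) (there q) =
    cong₂ _+_ (𝟙-no (Q? _) (λ qx → clash qx x∼xs q)) (count-unique distinct q)

module Burnside {R : Subgroup} (T' : TileSet R) (n : ℕ) where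

  open DecSetoid (tilingSetoid n (m T')) using (_≈_) renaming (sym to ≈-sym)

  X : List (Tiling n (m T'))
  X = allTilings n (m T')

  IsTranslate : (g : D8) → g ∈ R → Tiling n (m T') → Tiling n (m T') → Set
  IsTranslate g p σ τ = ∀ c → σ (c ⊙ g) ≡ act T' (τ c) g p

  translate? : ∀ g p σ τ → Dec (IsTranslate g p σ τ)
  translate? g p σ τ = map′ (λ eq (x , y) → eq x y) (λ eq x y → eq (x , y))
    (all? (λ x → all? (λ y → σ ((x , y) ⊙ g) ≟ act T' (τ (x , y)) g p)))

  translate : ∀ g → g ∈ R → Tiling n (m T') → Tiling n (m T')
  translate g p τ c = act T' (τ (c ⊙ inv g)) g p

  translate-correct : ∀ g p τ → IsTranslate g p (translate g p τ) τ
  translate-correct g p τ c = cong (λ d → act T' (τ d) g p) (⊙-·-inv c g)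

  translate-unique : ∀ {g p σ σ′ τ} → IsTranslate g p σ τ → IsTranslate g p σ′ τ → σ ≈ σ′
  translate-unique {g} {σ = σ} {σ′} t t′ c = begin
      σ c                       ≡⟨ cong σ (⊙-inv-· c g) ⟨
      σ (c ⊙ inv g ⊙ g)         ≡⟨ trans (t (c ⊙ inv g)) (sym (t′ (c ⊙ inv g))) ⟩
      σ′ (c ⊙ inv g ⊙ g)        ≡⟨ cong σ′ (⊙-inv-· c g) ⟩
      σ′ c                      ∎
    where open ≡-Reasoning

  translate-resp : ∀ {g p σ σ′ τ τ′} → σ ≈ σ′ → τ ≈ τ′ → IsTranslate g p σ τ → IsTranslate g p σ′ τ′
  translate-resp {g} {p} σ≈σ′ τ≈τ′ t c = trans (sym (σ≈σ′ _)) (trans (t c) (cong (λ d → act T' d g p) (τ≈τ′ c)))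

  translate-irrelevant : ∀ {g p q σ τ} → IsTranslate g p σ τ → IsTranslate g q σ τ
  translate-irrelevant {g} {p} {q} {τ = τ} t c = trans (t c) (cong (act T' (τ c) g) (T-irrelevant p q))

  translate-e : ∀ {σ τ} → σ ≈ τ → IsTranslate e (mem-e R) σ τ
  translate-e σ≈τ c = trans (σ≈τ c) (sym (act-e T' _))

  translate-∘ : ∀ {g h p q ρ σ τ} → IsTranslate g p σ τ → IsTranslate h q ρ σ →
                IsTranslate (g · h) (mem-· R p q) ρ τ
  translate-∘ {g} {h} {p} {q} {ρ} {σ} {τ} t t′ c = begin
      ρ (c ⊙ (g · h))           ≡⟨ cong ρ (⊙-· c g h) ⟩
      ρ (c ⊙ g ⊙ h)             ≡⟨ t′ (c ⊙ g) ⟩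
      act T' (σ (c ⊙ g)) h q    ≡⟨ cong (λ d → act T' d h q) (t c) ⟩
      act T' (act T' (τ c) g p) h q ≡⟨ act-· T' (τ c) p q ⟩
      act T' (τ c) (g · h) (mem-· R p q) ∎
    where open ≡-Reasoning

  translate-inv : ∀ {g p σ τ} → IsTranslate g p σ τ → IsTranslate (inv g) (mem-inv R p) τ σ
  translate-inv {g} {p} {σ} {τ} t c = sym (begin
      act T' (σ c) (inv g) p⁻¹                          ≡⟨ cong (λ d → act T' (σ d) (inv g) p⁻¹) (⊙-inv-· c g) ⟨
      act T' (σ (c ⊙ inv g ⊙ g)) (inv g) p⁻¹            ≡⟨ cong (λ d → act T' d (inv g) p⁻¹) (t (c ⊙ inv g)) ⟩
      act T' (act T' (τ (c ⊙ inv g)) g p) (inv g) p⁻¹   ≡⟨ act-· T' _ p p⁻¹ ⟩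
      act T' (τ (c ⊙ inv g)) (g · inv g) _              ≡⟨ act-cong T' _ (·-inv g) _ (mem-e R) ⟩
      act T' (τ (c ⊙ inv g)) e (mem-e R)                ≡⟨ act-e T' _ ⟩
      τ (c ⊙ inv g)                                     ∎)
    where
    open ≡-Reasoning
    p⁻¹ = mem-inv R p

  SameOrbit-refl : ∀ {σ τ} → σ ≈ τ → SameOrbit T' σ τ
  SameOrbit-refl σ≈τ = e , mem-e R , translate-e σ≈τ

  SameOrbit-sym : ∀ {σ τ} → SameOrbit T' σ τ → SameOrbit T' τ σ
  SameOrbit-sym (g , p , t) = inv g , mem-inv R p , translate-inv t

  SameOrbit-trans : ∀ {ρ σ τ} → SameOrbit T' ρ σ → SameOrbit T' σ τ → SameOrbit T' ρ τ
  SameOrbit-trans {ρ} {σ} {τ} (g , p , t) (h , q , t′) = h · g , mem-· R q p , translate-∘ {ρ = ρ} {σ} {τ} t′ t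

  sameOrbit? : ∀ σ τ → Dec (SameOrbit T' σ τ)
  sameOrbit? σ τ = map′ (λ a → satisfied a) (λ (g , q) → Any.map (λ { refl → q }) (complete g))
                        (any? translate-in-R? allD8)
    where
    complete : ∀ g → Any (g ≡_) allD8
    complete g = Any.map sym (Enumeration.∈-enumeration (decSetoid _≟ᴰ_) {allD8} allD8-enumeration g)
    translate-in-R? : ∀ g → Dec (Σ (g ∈ R) λ p → IsTranslate g p σ τ)
    translate-in-R? g with T? (mem R g)
    ... | yes p = map′ (p ,_) (λ (_ , t) → translate-irrelevant {σ = σ} {τ} t) (translate? g p σ τ)
    ... | no ¬p = no (λ (p , _) → ¬p p)

  insert : Tiling n (m T') → List (Tiling n (m T')) → List (Tiling n (m T'))
  insert τ ρs with any? (sameOrbit? τ) ρs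
  ... | yes _ = ρs
  ... | no _  = τ ∷ ρs

  representatives : List (Tiling n (m T'))
  representatives = foldr insert [] X

  private
    covers : ∀ xs → All (λ τ → Any (SameOrbit T' τ) (foldr insert [] xs)) xs
    covers []       = []
    covers (τ ∷ xs) with any? (sameOrbit? τ) (foldr insert [] xs)
    ... | yes found = found ∷ covers xs
    ... | no _      = here (SameOrbit-refl (λ _ → refl)) ∷ All.map there (covers xs)

  representatives-distinct : AllPairs (λ σ τ → ¬ SameOrbit T' σ τ) representatives
  representatives-distinct = go X
    where
    go : ∀ xs → AllPairs (λ σ τ → ¬ SameOrbit T' σ τ) (foldr insert [] xs)
    go []       = []
    go (τ ∷ xs) with any? (sameOrbit? τ) (foldr insert [] xs)
    ... | yes _   = go xs
    ... | no none = ¬Any⇒All¬ _ none ∷ go xs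

  representatives-cover : ∀ τ → Any (SameOrbit T' τ) representatives
  representatives-cover τ = All.lookupWith (λ found σ≈τ → Any.map (SameOrbit-trans {τ} (SameOrbit-refl (≈-sym σ≈τ))) found)
    (covers X) (Enumeration.∈-enumeration (tilingSetoid n (m T')) {X} (allTilings-enumeration n (m T')) τ)

  ∑ᴿ : ((g : D8) → g ∈ R → ℕ) → ℕ
  ∑ᴿ F = ∑[ g ← allD8 ] ifIn (mem R g) (F g)

  ∑ᴿ-cong : ∀ {F F′} → (∀ g p → F g p ≡ F′ g p) → ∑ᴿ F ≡ ∑ᴿ F′
  ∑ᴿ-cong {F′ = F′} eq = ∑-cong allD8 (λ g → ifIn-cong (λ p → p) (λ p → p)
    (λ p p′ → trans (eq g p) (cong (F′ g) (T-irrelevant p p′))))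

  ∑ᴿ-zero : ∀ {F} → (∀ g p → F g p ≡ 0) → ∑ᴿ F ≡ 0
  ∑ᴿ-zero eq = ∑-zero allD8 (λ g → at (mem R g) (eq g))
    where
    at : ∀ b {F : T b → ℕ} → (∀ p → F p ≡ 0) → ifIn b F ≡ 0
    at true  eq = eq tt
    at false eq = refl

  ∑ᴿ-swap : ∀ {A : Set} (xs : List A) (h : (g : D8) → g ∈ R → A → ℕ) →
            ∑ᴿ (λ g p → ∑ xs (h g p)) ≡ ∑[ x ← xs ] ∑ᴿ (λ g p → h g p x)
  ∑ᴿ-swap xs h = trans (∑-cong allD8 (λ g → ifIn-∑ (mem R g) xs (h g)))
    (∑-comm allD8 xs (λ g x → ifIn (mem R g) (λ p → h g p x)))

  ∑ᴿ-translate : ∀ {k} (q : k ∈ R) (F : (g : D8) → g ∈ R → ℕ) →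
                 ∑ᴿ (λ g p → F (k · g) (mem-· R q p)) ≡ ∑ᴿ F
  ∑ᴿ-translate {k} q F = trans
    (∑-cong allD8 (λ g → ifIn-cong (mem-· R q)
      (λ p → subst (_∈ R) (inv-·-cancel k g) (mem-· R (mem-inv R q) p))
      (λ p p′ → cong (F (k · g)) (T-irrelevant (mem-· R q p) p′))))
    (Enumeration.∑-reindex (decSetoid _≟ᴰ_) {allD8} allD8-enumeration (λ g → ifIn (mem R g) (F g))
      (cong _) (k ·_) (inv k ·_) (cong _) (cong _) (·-inv-cancel k) (inv-·-cancel k))

  order-∑ᴿ : order R ≡ ∑ᴿ (λ _ _ → 1)
  order-∑ᴿ = trans (length-filter (λ g → T? (mem R g)) allD8) (∑-cong allD8 (λ g → at (mem R g)))
    where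
    at : ∀ b → 𝟙 (T? b) ≡ ifIn b (λ _ → 1)
    at true  = refl
    at false = refl

  stabiliser : Tiling n (m T') → ℕ
  stabiliser τ = ∑ᴿ (λ g p → 𝟙 (translate? g p τ τ))

  translate-≡ : ∀ {g h p q σ τ} → g ≡ h → IsTranslate g p σ τ → IsTranslate h q σ τ
  translate-≡ {σ = σ} {τ} refl = translate-irrelevant {σ = σ} {τ}

  translations : ∀ τ ρ → ∑ᴿ (λ g p → 𝟙 (translate? g p τ ρ)) ≡ 𝟙 (sameOrbit? τ ρ) * stabiliser τ
  translations τ ρ with sameOrbit? τ ρ
  ... | no different = ∑ᴿ-zero (λ g p → 𝟙-no (translate? g p τ ρ) (λ t → different (g , p , t)))
  ... | yes (g₀ , p₀ , t₀) = begin
      ∑ᴿ (λ g p → 𝟙 (translate? g p τ ρ))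
    ≡⟨ ∑ᴿ-translate p₀ (λ g p → 𝟙 (translate? g p τ ρ)) ⟨
      ∑ᴿ (λ g p → 𝟙 (translate? (g₀ · g) (mem-· R p₀ p) τ ρ))
    ≡⟨ ∑ᴿ-cong (λ g p → 𝟙-⇔ (translate? (g₀ · g) (mem-· R p₀ p) τ ρ) (translate? g p τ τ)
         (λ t → translate-≡ {σ = τ} {τ} (inv-·-cancel g₀ g) (translate-∘ {ρ = τ} {ρ} {τ} (translate-inv {σ = τ} {ρ} t₀) t))
         (λ t → translate-∘ {ρ = τ} {τ} {ρ} t₀ t)) ⟩
      stabiliser τ
    ≡⟨ +-identityʳ (stabiliser τ) ⟨
      1 * stabiliser τ ∎
    where open ≡-Reasoning

  translate-count : ∀ g p ρ → ∑[ τ ← X ] 𝟙 (translate? g p τ ρ) ≡ 1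
  translate-count g p ρ = Enumeration.count-≈ (tilingSetoid n (m T')) {X} (allTilings-enumeration n (m T'))
    (λ τ → translate? g p τ ρ) (translate g p ρ)
    (λ t → translate-unique {σ = _} {translate g p ρ} {ρ} t (translate-correct g p ρ))
    (λ τ≈ → translate-resp {σ = translate g p ρ} {τ′ = ρ} (≈-sym τ≈) (λ _ → refl) (translate-correct g p ρ))

  burnside : order R * length representatives ≡ sumFix T' n
  burnside = sym (begin
      sumFix T' n
    ≡⟨ ∑ᴿ-cong (λ g p → trans (length-filter (λ τ → fixedBy? T' τ g p) X)
                                (∑-cong X (λ τ → 𝟙-⇔ (fixedBy? T' τ g p) (translate? g p τ τ) (λ t → t) (λ t → t)))) ⟩
      ∑ᴿ (λ g p → ∑[ τ ← X ] 𝟙 (translate? g p τ τ))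
    ≡⟨ ∑ᴿ-swap X (λ g p τ → 𝟙 (translate? g p τ τ)) ⟩
      ∑[ τ ← X ] stabiliser τ
    ≡⟨ ∑-cong X (λ τ → trans (sym (+-identityʳ (stabiliser τ)))
         (trans (cong (_* stabiliser τ) (sym (one-representative τ))) (sym (∑-*ʳ reps (stabiliser τ) _)))) ⟩
      ∑[ τ ← X ] ∑[ ρ ← reps ] (𝟙 (sameOrbit? τ ρ) * stabiliser τ)
    ≡⟨ ∑-cong X (λ τ → ∑-cong reps (λ ρ → sym (translations τ ρ))) ⟩
      ∑[ τ ← X ] ∑[ ρ ← reps ] ∑ᴿ (λ g p → 𝟙 (translate? g p τ ρ))
    ≡⟨ ∑-comm X reps _ ⟩
      ∑[ ρ ← reps ] ∑[ τ ← X ] ∑ᴿ (λ g p → 𝟙 (translate? g p τ ρ))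
    ≡⟨ ∑-cong reps (λ ρ → sym (∑ᴿ-swap X (λ g p τ → 𝟙 (translate? g p τ ρ)))) ⟩
      ∑[ ρ ← reps ] ∑ᴿ (λ g p → ∑[ τ ← X ] 𝟙 (translate? g p τ ρ))
    ≡⟨ ∑-cong reps (λ ρ → trans (∑ᴿ-cong (λ g p → translate-count g p ρ)) (sym order-∑ᴿ)) ⟩
      ∑[ ρ ← reps ] order R
    ≡⟨ ∑-const reps (order R) ⟩
      length reps * order R
    ≡⟨ *-comm (length reps) (order R) ⟩
      order R * length reps ∎)
    where
    open ≡-Reasoning
    reps = representatives
    one-representative : ∀ τ → ∑[ ρ ← reps ] 𝟙 (sameOrbit? τ ρ) ≡ 1
    one-representative τ = count-unique (sameOrbit? τ)
      (λ {ρ} {ρ′} τ~ρ τ~ρ′ ρ≁ρ′ → ρ≁ρ′ (SameOrbit-trans {ρ} {τ} {ρ′} (SameOrbit-sym {τ} {ρ} τ~ρ) τ~ρ′))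
      representatives-distinct (representatives-cover τ)

module _ {R : Subgroup} (T' : TileSet R) where

  tcount-powers : ∀ {g h} (p : g ∈ R) (q : h ∈ R) i j → h ≡ g ^ᴰ i → g ≡ h ^ᴰ j → tcount T' g p ≡ tcount T' h q
  tcount-powers {g} {h} p q i j h≡gⁱ g≡hʲ = trans (length-filter _ (allFin (m T')))
    (trans (∑-cong (allFin (m T')) (λ d → 𝟙-⇔ (act T' d g p ≟ d) (act T' d h q ≟ d)
             (λ fx → trans (act-cong T' d h≡gⁱ q (mem-^ T' p i)) (fixed-^ p fx i))
             (λ fx → trans (act-cong T' d g≡hʲ p (mem-^ T' q j)) (fixed-^ q fx j))))
           (sym (length-filter _ (allFin (m T')))))
    where
    fixed-^ : ∀ {g d} (p : g ∈ R) → act T' d g p ≡ d → ∀ i → act T' d (g ^ᴰ i) (mem-^ T' p i) ≡ d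
    fixed-^ p fx i = trans (sym (fold-act T' p _ i)) (fold-fixed fx i)

  module _ {n} (1≤n : 1 ≤ n) where

    private
      tid = tcount T' e (mem-e R)

    fix-no-fixed-cell : ∀ g (p : g ∈ R) N ⦃ _ : NonZero N ⦄ → g ^ᴰ N ≡ e → NoShortOrbits N (λ (c : Cell n) → c ⊙ g) →
                              fixedCells n g ≡ 0 → Fix T' n g p ≡ tid ^ (n * n / N)
    fix-no-fixed-cell g p N gᴺ≡e no-short-orbits F≡0 = trans (fix-formula T' 1≤n g p N gᴺ≡e no-short-orbits F≡0) (*-identityʳ _)

    fix-one-fixed-cell : ∀ g (p : g ∈ R) N ⦃ _ : NonZero N ⦄ → g ^ᴰ N ≡ e → NoShortOrbits N (λ (c : Cell n) → c ⊙ g) →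
                         fixedCells n g ≡ 1 → Fix T' n g p ≡ tid ^ ((n * n ∸ 1) / N) * tcount T' g p
    fix-one-fixed-cell g p N gᴺ≡e no-short-orbits F≡1 = trans (fix-formula T' 1≤n g p N gᴺ≡e no-short-orbits F≡1) (cong (tid ^ ((n * n ∸ 1) / N) *_) (*-identityʳ _))

    fix-identity : (p : e ∈ R) → Fix T' n e p ≡ tid ^ (n * n)
    fix-identity p = begin
        Fix T' n e p
      ≡⟨ fix-formula T' 1≤n e p 1 refl (noShortOrbits-1 _) (fixedCells-e n) ⟩
        tid ^ ((n * n ∸ n * n) / 1) * tcount T' e p ^ (n * n)
      ≡⟨ cong₂ (λ a t → tid ^ (a / 1) * t ^ (n * n)) (n∸n≡0 (n * n)) (cong (tcount T' e) (T-irrelevant p (mem-e R))) ⟩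
        1 * tid ^ (n * n)
      ≡⟨ *-identityˡ _ ⟩
        tid ^ (n * n) ∎
      where open ≡-Reasoning

    fix-rotation : ∀ g (p : g ∈ R) N ⦃ _ : NonZero N ⦄ → g ^ᴰ N ≡ e → NoShortOrbits N (λ (c : Cell n) → c ⊙ g) →
                 fixedCells n g ≡ centres n * centres n →
                 (n % 2 ≡ 0 → Fix T' n g p ≡ tid ^ (n * n / N))
               × (n % 2 ≡ 1 → Fix T' n g p ≡ tid ^ ((n * n ∸ 1) / N) * tcount T' g p)
    fix-rotation g p N gᴺ≡e no-short-orbits F≡ =
        (λ even → let c = centres-even {n} even in fix-no-fixed-cell g p N gᴺ≡e no-short-orbits (trans F≡ (cong₂ _*_ c c)))
      , (λ odd  → let c = centres-odd {n} odd   in fix-one-fixed-cell g p N gᴺ≡e no-short-orbits (trans F≡ (cong₂ _*_ c c)))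

    fix-median-reflection : ∀ g (p : g ∈ R) → g ^ᴰ 2 ≡ e → fixedCells n g ≡ n * centres n →
                 (n % 2 ≡ 0 → Fix T' n g p ≡ tid ^ (n * n / 2))
               × (n % 2 ≡ 1 → Fix T' n g p ≡ tid ^ ((n * n ∸ n) / 2) * tcount T' g p ^ n)
    fix-median-reflection g p g²≡e F≡ =
        (λ even → fix-no-fixed-cell g p 2 g²≡e (noShortOrbits-2 _)
                    (trans F≡ (trans (cong (n *_) (centres-even {n} even)) (*-zeroʳ n))))
      , (λ odd  → fix-formula T' 1≤n g p 2 g²≡e (noShortOrbits-2 _) (trans F≡ (trans (cong (n *_) (centres-odd {n} odd)) (*-identityʳ n))))

noShortOrbits-r : ∀ {n} → NoShortOrbits 4 (λ (c : Cell n) → c ⊙ r)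
noShortOrbits-r = noShortOrbits-4 _ (⊙-periodic r 4 refl) (λ c eq → r²-fixed⇒r-fixed c (trans (⊙-· c r r) eq))

noShortOrbits-r³ : ∀ {n} → NoShortOrbits 4 (λ (c : Cell n) → c ⊙ r³)
noShortOrbits-r³ = noShortOrbits-4 _ (⊙-periodic r³ 4 refl) (λ c eq → r²-fixed⇒r³-fixed c (trans (⊙-· c r³ r³) eq))

mainTheorem3 :
    (n : ℕ) → 1 ≤ n → (R : Subgroup) → (T' : TileSet R) →
    let t = tcount T'
        tid = t e (mem-e R)
    in
      (∀ (p : e ∈ R) → Fix T' n e p ≡ tid ^ (n * n))
    × (∀ (p : r² ∈ R) →
         (n % 2 ≡ 0 → Fix T' n r² p ≡ tid ^ (n * n / 2))
       × (n % 2 ≡ 1 → Fix T' n r² p ≡ tid ^ ((n * n ∸ 1) / 2) * t r² p))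
    × (∀ (p : f ∈ R) →
         (n % 2 ≡ 0 → Fix T' n f p ≡ tid ^ (n * n / 2))
       × (n % 2 ≡ 1 → Fix T' n f p ≡ tid ^ ((n * n ∸ n) / 2) * t f p ^ n))
    × (∀ (p : r²f ∈ R) →
         (n % 2 ≡ 0 → Fix T' n r²f p ≡ tid ^ (n * n / 2))
       × (n % 2 ≡ 1 → Fix T' n r²f p ≡ tid ^ ((n * n ∸ n) / 2) * t r²f p ^ n))
    × (∀ (p : r ∈ R) →
         (n % 2 ≡ 0 → Fix T' n r p ≡ tid ^ (n * n / 4))
       × (n % 2 ≡ 1 → Fix T' n r p ≡ tid ^ ((n * n ∸ 1) / 4) * t r p))
    × (∀ (p : r³ ∈ R) →
         (n % 2 ≡ 0 → Fix T' n r³ p ≡ tid ^ (n * n / 4))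
       × (n % 2 ≡ 1 → Fix T' n r³ p ≡
            tid ^ ((n * n ∸ 1) / 4) * t r (mem-· R (mem-· R p p) p)))
    × (∀ (p : rf ∈ R) → Fix T' n rf p ≡ tid ^ ((n * n ∸ n) / 2) * t rf p ^ n)
    × (∀ (p : r³f ∈ R) → Fix T' n r³f p ≡ tid ^ ((n * n ∸ n) / 2) * t r³f p ^ n)
    × (Σ ℕ λ N → IsOrbitCount T' n N × order R * N ≡ sumFix T' n)
mainTheorem3 n 1≤n R T' =
    fix-identity T' 1≤n
  , (λ p → fix-rotation T' 1≤n r² p 2 refl (noShortOrbits-2 _) (fixedCells-r² n))
  , (λ p → fix-median-reflection T' 1≤n f p refl (fixedCells-f n))
  , (λ p → fix-median-reflection T' 1≤n r²f p refl (fixedCells-r²f n))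
  , (λ p → fix-rotation T' 1≤n r p 4 refl noShortOrbits-r (fixedCells-r n))
  , (λ p → let (even , odd) = fix-rotation T' 1≤n r³ p 4 refl noShortOrbits-r³ (fixedCells-r³ n) in
           even , (λ n-odd → trans (odd n-odd) (cong (tcount T' e (mem-e R) ^ ((n * n ∸ 1) / 4) *_)
                                 (tcount-powers T' p (mem-· R (mem-· R p p) p) 3 3 refl refl))))
  , (λ p → fix-formula T' 1≤n rf p 2 refl (noShortOrbits-2 _) (fixedCells-rf n))
  , (λ p → fix-formula T' 1≤n r³f p 2 refl (noShortOrbits-2 _) (fixedCells-r³f n))
  , (length representatives , (representatives , refl , representatives-cover , representatives-distinct) , burnside)
  where open Burnside T' n
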